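{- Let $n=9$ or $n\ge 11$, and let $G=H_{n,1,q}$ for some $q\in\{3,\dots,\lfloor n/2\rfloor\}$. Then $$W(G)<W(H_{n,2,2})<W(H_{n,1,2}).$$ Moreover, for small $n$ the following values hold: $W(H_{4,1,2})=7$; $W(H_{5,1,2})=14$, $W(H_{5,2,2})=14$; $W(H_{6,1,2})=24$, $W(H_{6,1,3})=25$, $W(H_{6,2,2})=23$; $W(H_{7,1,2})=39$, $W(H_{7,1,3})=38$, $W(H_{7,2,2})=38$; $W(H_{8,1,2})=58$, $W(H_{8,1,3})=58$, $W(H_{8,1,4})=55$, $W(H_{8,2,2})=56$; $W(H_{10,1,2})=115$, $W(H_{10,1,3})=113$, $W(H_{10,1,4})=107$, $W(H_{10,1,5})=109$, $W(H_{10,2,2})=112$.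
   Context: All graphs are finite and simple. For a connected graph $G$, $d_G(u,v)$ is the distance between $u$ and $v$, and the Wiener index is $W(G)=\sum_{\{u,v\}\subseteq V(G)} d_G(u,v)$ (sum over unordered pairs of distinct vertices). For integers $p,q$ with $1\le p\le q\le n-p-q+1$ and $q>1$, $H_{n,p,q}$ is the graph on $n$ vertices consisting of three internally disjoint paths between the same two end-vertices, of lengths $p$, $q$ and $n-p-q+1$ (a path of length 1 is an edge). -}

module Defs where

open import Data.Nat using (ℕ; zero; suc; _+_; _∸_; _≡ᵇ_)
open import Data.Bool using (Bool; true; false; _∨_; _∧_; if_then_else_)
open import Data.List using (List; []; _∷_; _++_; map; upTo)
open import Data.Nat.ListAction using (sum)
open import Data.Bool.ListAction using (any)
open import Data.Product using (_×_; _,_)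

record Graph : Set where
  field
    order : ℕ
    adj   : ℕ → ℕ → Bool
open Graph public

verts : Graph → List ℕ
verts G = upTo (order G)

reach : (G : Graph) → ℕ → ℕ → ℕ → Bool
reach G zero    u v = u ≡ᵇ v
reach G (suc k) u v = reach G k u v ∨ any (λ w → reach G k u w ∧ adj G w v) (verts G)

-- least k ≤ bound such that reach G k u v (bound returned if none)
distFrom : (G : Graph) → ℕ → ℕ → ℕ → ℕ → ℕ
distFrom G k zero      u v = k
distFrom G k (suc fuel) u v = if reach G k u v then k else distFrom G (suc k) fuel u v

-- graph distance d_G(u,v): length of a shortest u–v walk (= shortest path);
-- in a connected graph on n vertices it is < n, so searching k = 0..n suffices.
dist : Graph → ℕ → ℕ → ℕ
dist G u v = distFrom G 0 (order G) u v

wiener : Graph → ℕ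
wiener G = sum (map (λ v → sum (map (λ u → dist G u v) (upTo v))) (verts G))

pathEdges : List ℕ → List (ℕ × ℕ)
pathEdges []            = []
pathEdges (x ∷ [])      = []
pathEdges (x ∷ y ∷ xs)  = (x , y) ∷ pathEdges (y ∷ xs)

range : ℕ → ℕ → List ℕ
range s zero    = []
range s (suc m) = s ∷ range (suc s) m

thetaPath : ℕ → ℕ → List ℕ
thetaPath s len = 0 ∷ (range s (len ∸ 1) ++ (1 ∷ []))

-- edge list of H_{n,p,q}: three internally disjoint 0–1 paths of lengths
-- p, q, n-p-q+1; internal vertices 2..p, p+1..p+q-1, p+q..n-1
thetaEdges : ℕ → ℕ → ℕ → List (ℕ × ℕ)
thetaEdges n p q =
  pathEdges (thetaPath 2 p) ++ pathEdges (thetaPath (p + 1) q)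
    ++ pathEdges (thetaPath (p + q) ((n + 1) ∸ (p + q)))

edgeIn : List (ℕ × ℕ) → ℕ → ℕ → Bool
edgeIn es u v = any (λ { (a , b) → ((a ≡ᵇ u) ∧ (b ≡ᵇ v)) ∨ ((a ≡ᵇ v) ∧ (b ≡ᵇ u)) }) es

H : ℕ → ℕ → ℕ → Graph
H n p q = record { order = n ; adj = edgeIn (thetaEdges n p q) }

-- Choosing two of the three paths of H_{n,p,q} as a cycle C_b, the third is an ear whose ends lie at distance δ
-- on it. All distances are then explicit: between cycle vertices they are distances in C_b, between ear vertices
-- distances in the cycle C_E formed by the ear and the short arc, and from an ear vertex to the cycle a shortest
-- path leaves through the nearer end of the ear. Summing these gives 2W in closed form in terms of the
-- transmissions σ m = ⌊m²/4⌋ of cycles, for H_{n,1,q} (δ = 1) and for H_{n,2,2} (δ = 2). Since σ depends on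
-- parities, each comparison splits into parity classes of q and n, where it becomes a polynomial identity with a
-- nonnegative slack; the small values are read off the same closed forms.
module Submission where

open import Defs
open import Data.Nat using (ℕ; zero; suc; _+_; _*_; _∸_; _≤_; _<_; z≤n; s≤s; s≤s⁻¹; _⊓_; ∣_-_∣; _≡ᵇ_; _≟_; _≤?_; _<?_; _/_)
open import Data.Nat.Properties
open import Data.Nat.DivMod using (m/n*n≤m)
open import Data.Nat.Tactic.RingSolver
open import Data.Bool using (Bool; true; false; _∨_; _∧_)
open import Data.List using (List; []; _∷_; _++_; map; applyUpTo)
open import Data.Nat.ListAction using (sum)
open import Data.Bool.ListAction using (any)
open import Data.Product using (_×_; _,_; ∃; proj₁; proj₂)
open import Data.Sum using (_⊎_; inj₁; inj₂)
open import Data.Empty using (⊥; ⊥-elim)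
open import Function using (_∘_; id)
open import Relation.Nullary using (¬_; yes; no)
open import Relation.Nullary.Decidable using (True; toWitness; from-yes)
open import Relation.Binary.Definitions using (tri<; tri≈; tri>)
open import Relation.Binary.PropositionalEquality
open ≡-Reasoning

-- Reachability and the distance

∨-true⁻ : ∀ a b → a ∨ b ≡ true → a ≡ true ⊎ b ≡ true
∨-true⁻ true  b _ = inj₁ refl
∨-true⁻ false b e = inj₂ e

∧-true⁻ : ∀ a b → a ∧ b ≡ true → a ≡ true × b ≡ true
∧-true⁻ true true _ = refl , refl

∨-true⁺ʳ : ∀ a {b} → b ≡ true → a ∨ b ≡ true
∨-true⁺ʳ true  _ = refl
∨-true⁺ʳ false e = e

∨-true⁺ˡ : ∀ {a} b → a ≡ true → a ∨ b ≡ true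
∨-true⁺ˡ b refl = refl

∧-true⁺ : ∀ {a b} → a ≡ true → b ≡ true → a ∧ b ≡ true
∧-true⁺ refl refl = refl

≡ᵇ-true⇒≡ : ∀ m n → (m ≡ᵇ n) ≡ true → m ≡ n
≡ᵇ-true⇒≡ zero    zero    _ = refl
≡ᵇ-true⇒≡ (suc m) (suc n) e = cong suc (≡ᵇ-true⇒≡ m n e)

≡ᵇ-refl : ∀ m → (m ≡ᵇ m) ≡ true
≡ᵇ-refl zero    = refl
≡ᵇ-refl (suc m) = ≡ᵇ-refl m

any-applyUpTo⁻ : ∀ (P : ℕ → Bool) f n → any P (applyUpTo f n) ≡ true → ∃ λ k → k < n × P (f k) ≡ true
any-applyUpTo⁻ P f (suc n) e with ∨-true⁻ (P (f 0)) _ e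
... | inj₁ e₀ = 0 , s≤s z≤n , e₀
... | inj₂ e₁ with any-applyUpTo⁻ P (f ∘ suc) n e₁
... | k , k<n , pk = suc k , s≤s k<n , pk

any-applyUpTo⁺ : ∀ (P : ℕ → Bool) f n k → k < n → P (f k) ≡ true → any P (applyUpTo f n) ≡ true
any-applyUpTo⁺ P f (suc n) zero    _         e = ∨-true⁺ˡ _ e
any-applyUpTo⁺ P f (suc n) (suc k) (s≤s k<n) e = ∨-true⁺ʳ (P (f 0)) (any-applyUpTo⁺ P (f ∘ suc) n k k<n e)

module Walks (G : Graph) where
  n = order G

  Reach : ℕ → ℕ → ℕ → Set
  Reach k u v = reach G k u v ≡ true

  reach-suc : ∀ k u v → Reach k u v → Reach (suc k) u v
  reach-suc k u v e = ∨-true⁺ˡ _ e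

  reach-step : ∀ k u w v → w < n → Reach k u w → adj G w v ≡ true → Reach (suc k) u v
  reach-step k u w v w<n e₁ e₂ = ∨-true⁺ʳ (reach G k u v)
    (any-applyUpTo⁺ (λ z → reach G k u z ∧ adj G z v) (λ x → x) n w w<n (∧-true⁺ e₁ e₂))

  reach-refl : ∀ u → Reach 0 u u
  reach-refl u = ≡ᵇ-refl u

  reach-last-step : ∀ k u v → Reach (suc k) u v → Reach k u v ⊎ ∃ λ w → w < n × Reach k u w × adj G w v ≡ true
  reach-last-step k u v e with ∨-true⁻ (reach G k u v) _ e
  ... | inj₁ e₁ = inj₁ e₁
  ... | inj₂ e₂ with any-applyUpTo⁻ (λ z → reach G k u z ∧ adj G z v) (λ x → x) n e₂
  ... | w , w<n , ew with ∧-true⁻ (reach G k u w) _ ew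
  ... | ea , eb = inj₂ (w , w<n , ea , eb)

  reach-trans : ∀ k m u w v → Reach k u w → Reach m w v → Reach (k + m) u v
  reach-trans k zero u w v e₁ e₂ with ≡ᵇ-true⇒≡ w v e₂
  ... | refl = subst (λ x → Reach x u w) (sym (+-identityʳ k)) e₁
  reach-trans k (suc m) u w v e₁ e₂ = subst (λ x → Reach x u v) (sym (+-suc k m)) (extend (reach-last-step m w v e₂))
    where
    extend : Reach m w v ⊎ (∃ λ z → z < n × Reach m w z × adj G z v ≡ true) → Reach (suc (k + m)) u v
    extend (inj₁ e) = reach-suc (k + m) u v (reach-trans k m u w v e₁ e)
    extend (inj₂ (z , z<n , ea , eb)) = reach-step (k + m) u z v z<n (reach-trans k m u w z e₁ ea) eb

  reach-edge : ∀ u v → u < n → adj G u v ≡ true → Reach 1 u v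
  reach-edge u v u<n e = reach-step 0 u u v u<n (reach-refl u) e

  -- A function that is 0 on the diagonal, grows by at most one along an edge and is realised by
  -- walks is the graph distance: it bounds every walk length from below, so the search in distFrom stops exactly at it.
  module DistanceFormula (f : ℕ → ℕ → ℕ)
    (f-step : ∀ u v w → u < n → v < n → w < n → adj G w v ≡ true → f u v ≤ suc (f u w))
    (f-diag : ∀ u → u < n → f u u ≡ 0)
    (f-reach : ∀ u v → u < n → v < n → Reach (f u v) u v)
    (f-bounded : ∀ u v → u < n → v < n → f u v ≤ n) where

    reach⇒f≤ : ∀ k u v → u < n → v < n → Reach k u v → f u v ≤ k
    reach⇒f≤ zero u v u<n v<n e with ≡ᵇ-true⇒≡ u v e
    ... | refl = ≤-reflexive (f-diag u u<n)
    reach⇒f≤ (suc k) u v u<n v<n e with reach-last-step k u v e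
    ... | inj₁ e₁ = m≤n⇒m≤1+n (reach⇒f≤ k u v u<n v<n e₁)
    ... | inj₂ (w , w<n , ea , eb) = ≤-trans (f-step u v w u<n v<n w<n eb) (s≤s (reach⇒f≤ k u w u<n w<n ea))

    distFrom≡f : ∀ fuel k u v → u < n → v < n → k ≤ f u v → f u v ≤ k + fuel → distFrom G k fuel u v ≡ f u v
    distFrom≡f zero k u v u<n v<n k≤f f≤ = ≤-antisym k≤f (subst (f u v ≤_) (+-identityʳ k) f≤)
    distFrom≡f (suc fuel) k u v u<n v<n k≤f f≤ with reach G k u v in eq
    ... | true  = ≤-antisym k≤f (reach⇒f≤ k u v u<n v<n eq)
    ... | false = distFrom≡f fuel (suc k) u v u<n v<n (≤∧≢⇒< k≤f k≢f) (subst (f u v ≤_) (+-suc k fuel) f≤)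
      where
      k≢f : ¬ (k ≡ f u v)
      k≢f refl with trans (sym eq) (f-reach u v u<n v<n)
      ... | ()

    dist≡f : ∀ u v → u < n → v < n → dist G u v ≡ f u v
    dist≡f u v u<n v<n = distFrom≡f n 0 u v u<n v<n z≤n (f-bounded u v u<n v<n)

-- Finite sums

∑ : (ℕ → ℕ) → ℕ → ℕ
∑ g zero    = 0
∑ g (suc n) = ∑ g n + g n

∑-sucˡ : ∀ g n → ∑ g (suc n) ≡ g 0 + ∑ (λ k → g (suc k)) n
∑-sucˡ g zero    = +-comm 0 (g 0)
∑-sucˡ g (suc n) = trans (cong (_+ g (suc n)) (∑-sucˡ g n)) (+-assoc (g 0) _ _)

sum-map-applyUpTo : ∀ (g f : ℕ → ℕ) n → sum (map g (applyUpTo f n)) ≡ ∑ (λ k → g (f k)) n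
sum-map-applyUpTo g f zero    = refl
sum-map-applyUpTo g f (suc n) =
  trans (cong (g (f 0) +_) (sum-map-applyUpTo g (λ k → f (suc k)) n)) (sym (∑-sucˡ (λ k → g (f k)) n))

∑-cong : ∀ g h n → (∀ k → k < n → g k ≡ h k) → ∑ g n ≡ ∑ h n
∑-cong g h zero    e = refl
∑-cong g h (suc n) e = cong₂ _+_ (∑-cong g h n (λ k k<n → e k (m<n⇒m<1+n k<n))) (e n ≤-refl)

∑-+ : ∀ g m k → ∑ g (m + k) ≡ ∑ g m + ∑ (λ i → g (m + i)) k
∑-+ g m zero    = trans (cong (∑ g) (+-identityʳ m)) (sym (+-identityʳ _))
∑-+ g m (suc k) = begin
  ∑ g (m + suc k)                            ≡⟨ cong (∑ g) (+-suc m k) ⟩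
  ∑ g (m + k) + g (m + k)                    ≡⟨ cong (_+ g (m + k)) (∑-+ g m k) ⟩
  ∑ g m + ∑ (λ i → g (m + i)) k + g (m + k)  ≡⟨ +-assoc (∑ g m) _ _ ⟩
  ∑ g m + (∑ (λ i → g (m + i)) k + g (m + k)) ∎

∑-distrib : ∀ g h n → ∑ (λ k → g k + h k) n ≡ ∑ g n + ∑ h n
∑-distrib g h zero    = refl
∑-distrib g h (suc n) = trans (cong (_+ (g n + h n)) (∑-distrib g h n)) (+-interchange (∑ g n) _ _ _)
  where
  +-interchange : ∀ a b c d → a + b + (c + d) ≡ a + c + (b + d)
  +-interchange = solve-∀

∑-const : ∀ c n → ∑ (λ _ → c) n ≡ n * c
∑-const c zero    = refl
∑-const c (suc n) = trans (cong (_+ c) (∑-const c n)) (+-comm (n * c) c)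

∑-*ˡ : ∀ c g n → ∑ (λ k → c * g k) n ≡ c * ∑ g n
∑-*ˡ c g zero    = sym (*-zeroʳ c)
∑-*ˡ c g (suc n) = trans (cong (_+ c * g n) (∑-*ˡ c g n)) (sym (*-distribˡ-+ c (∑ g n) (g n)))

∑-reverse : ∀ g m → ∑ (λ i → g (m ∸ suc i)) m ≡ ∑ g m
∑-reverse g zero    = refl
∑-reverse g (suc m) = begin
  ∑ (λ i → g (suc m ∸ suc i)) (suc m) ≡⟨ ∑-sucˡ _ m ⟩
  g m + ∑ (λ k → g (m ∸ suc k)) m     ≡⟨ cong (g m +_) (∑-reverse g m) ⟩
  g m + ∑ g m                         ≡⟨ +-comm (g m) _ ⟩
  ∑ g (suc m)                         ∎

∑-swap : ∀ (f : ℕ → ℕ → ℕ) b l → ∑ (λ y → ∑ (λ i → f i y) l) b ≡ ∑ (λ i → ∑ (λ y → f i y) b) l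
∑-swap f zero    l = sym (trans (∑-cong _ (λ _ → 0) l (λ _ _ → refl)) (trans (∑-const 0 l) (*-zeroʳ l)))
∑-swap f (suc b) l = trans (cong (_+ ∑ (λ i → f i b) l) (∑-swap f b l))
                           (sym (∑-distrib (λ i → ∑ (λ y → f i y) b) (λ i → f i b) l))

2∑suc≡ : ∀ h → ∑ suc h + ∑ suc h ≡ h * suc h
2∑suc≡ zero = refl
2∑suc≡ (suc h) = trans (arith (∑ suc h) h) (trans (cong (λ z → z + suc h + suc h) (2∑suc≡ h)) (arith₂ h))
  where
  arith : ∀ a h → a + suc h + (a + suc h) ≡ a + a + suc h + suc h
  arith = solve-∀
  arith₂ : ∀ h → h * suc h + suc h + suc h ≡ suc h * suc (suc h)
  arith₂ = solve-∀

∑△ ∑□ : (ℕ → ℕ → ℕ) → ℕ → ℕ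
∑△ f n = ∑ (λ v → ∑ (λ u → f u v) v) n
∑□ f n = ∑ (λ v → ∑ (λ u → f u v) n) n

2∑△≡∑□ : ∀ f n → (∀ u v → u < n → v < n → f u v ≡ f v u) → (∀ u → u < n → f u u ≡ 0) →
  2 * ∑△ f n ≡ ∑□ f n
2∑△≡∑□ f zero    f-sym f-diag = refl
2∑△≡∑□ f (suc n) f-sym f-diag = begin
  2 * (∑△ f n + column)                 ≡⟨ *-distribˡ-+ 2 (∑△ f n) _ ⟩
  2 * ∑△ f n + 2 * column               ≡⟨ cong (_+ 2 * column) (2∑△≡∑□ f n (λ u v u< v< → f-sym u v (m<n⇒m<1+n u<) (m<n⇒m<1+n v<))
                                                                     (λ u u< → f-diag u (m<n⇒m<1+n u<))) ⟩
  ∑□ f n + 2 * column                   ≡⟨ cong (λ x → ∑□ f n + (x + (column + 0))) row≡column ⟨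
  ∑□ f n + (row + (column + 0))         ≡⟨ cong (λ x → ∑□ f n + (row + (column + x))) (f-diag n ≤-refl) ⟨
  ∑□ f n + (row + (column + f n n))     ≡⟨ +-assoc (∑□ f n) row _ ⟨
  ∑□ f n + row + (column + f n n)       ≡⟨ cong (_+ (column + f n n)) (∑-distrib (λ v → ∑ (λ u → f u v) n) (λ v → f n v) n) ⟨
  ∑□ f (suc n)                          ∎
  where
  column = ∑ (λ u → f u n) n
  row = ∑ (λ v → f n v) n
  row≡column : row ≡ column
  row≡column = ∑-cong (λ v → f n v) (λ u → f u n) n (λ k k< → f-sym n k ≤-refl (m<n⇒m<1+n k<))

-- The metric of the cycle C_m on positions 0, …, m-1

cdist : ℕ → ℕ → ℕ → ℕ
cdist m x y = ∣ x - y ∣ ⊓ (m ∸ ∣ x - y ∣)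

cdist-sym : ∀ m x y → cdist m x y ≡ cdist m y x
cdist-sym m x y rewrite ∣-∣-comm x y = refl

cdist-self : ∀ m x → cdist m x x ≡ 0
cdist-self m x rewrite ∣n-n∣≡0 x = refl

cdist≤∣-∣ : ∀ m x y → cdist m x y ≤ ∣ x - y ∣
cdist≤∣-∣ m x y = m⊓n≤m _ _

cdist≤m : ∀ m x y → cdist m x y ≤ m
cdist≤m m x y = ≤-trans (m⊓n≤n _ _) (m∸n≤m m ∣ x - y ∣)

cdist-shift : ∀ m x k → cdist m x (x + k) ≡ cdist m 0 k
cdist-shift m x k rewrite ∣m-m+n∣≡n x k = refl

∣m-n∣<o : ∀ {m n o} → m < o → n < o → ∣ m - n ∣ < o
∣m-n∣<o {m} {n} m<o n<o = ≤-<-trans (∣m-n∣≤m⊔n m n) (⊔-lub m<o n<o)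

⊓-complement-suc : ∀ m a a' → a' ≤ m → a ≤ suc a' → a' ≤ suc a → a ⊓ (m ∸ a) ≤ suc (a' ⊓ (m ∸ a'))
⊓-complement-suc m a a' a'≤m a≤ a'≤ =
  ⊓-mono-≤ a≤ (≤-trans (∸-monoʳ-≤ (suc m) a'≤) (≤-reflexive (+-∸-assoc 1 a'≤m)))

∣m-1+n∣≡1+n : ∀ n → ∣ n - suc n ∣ ≡ 1
∣m-1+n∣≡1+n n = trans (cong (λ z → ∣ n - z ∣) (+-comm 1 n)) (∣m-m+n∣≡n n 1)

∣m-1+n∣≤1+∣m-n∣ : ∀ m n → ∣ m - suc n ∣ ≤ suc ∣ m - n ∣
∣m-1+n∣≤1+∣m-n∣ m n = ≤-trans (∣-∣-triangle m n (suc n))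
  (≤-reflexive (trans (cong (∣ m - n ∣ +_) (∣m-1+n∣≡1+n n)) (+-comm _ 1)))

∣m-n∣≤1+∣m-1+n∣ : ∀ m n → ∣ m - n ∣ ≤ suc ∣ m - suc n ∣
∣m-n∣≤1+∣m-1+n∣ m n = ≤-trans (∣-∣-triangle m (suc n) n)
  (≤-reflexive (trans (cong (∣ m - suc n ∣ +_) (trans (∣-∣-comm (suc n) n) (∣m-1+n∣≡1+n n))) (+-comm _ 1)))

cdist-sucʳ-≤ : ∀ m x y → x < m → suc y < m → cdist m x (suc y) ≤ suc (cdist m x y)
cdist-sucʳ-≤ m x y x< sy< =
  ⊓-complement-suc m _ _ (<⇒≤ (∣m-n∣<o x< (<-trans (n<1+n y) sy<))) (∣m-1+n∣≤1+∣m-n∣ x y) (∣m-n∣≤1+∣m-1+n∣ x y)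

cdist-sucʳ-≥ : ∀ m x y → x < m → suc y < m → cdist m x y ≤ suc (cdist m x (suc y))
cdist-sucʳ-≥ m x y x< sy< =
  ⊓-complement-suc m _ _ (<⇒≤ (∣m-n∣<o x< sy<)) (∣m-n∣≤1+∣m-1+n∣ x y) (∣m-1+n∣≤1+∣m-n∣ x y)

cdist-sucˡ-≤ : ∀ m x y → suc x < m → y < m → cdist m (suc x) y ≤ suc (cdist m x y)
cdist-sucˡ-≤ m x y sx< y< rewrite cdist-sym m (suc x) y | cdist-sym m x y = cdist-sucʳ-≤ m y x y< sx<

cdist-sucˡ-≥ : ∀ m x y → suc x < m → y < m → cdist m x y ≤ suc (cdist m (suc x) y)
cdist-sucˡ-≥ m x y sx< y< rewrite cdist-sym m (suc x) y | cdist-sym m x y = cdist-sucʳ-≥ m y x y< sx<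

⊓-swap-≤-suc : ∀ p q r s → p ≤ suc s → q ≤ suc r → p ⊓ q ≤ suc (r ⊓ s)
⊓-swap-≤-suc p q r s p≤ q≤ = ⊓-glb (≤-trans (m⊓n≤n p q) q≤) (≤-trans (m⊓n≤m p q) p≤)

cdist-last : ∀ k x → x < suc (suc k) → cdist (suc (suc k)) x (suc k) ≡ (suc k ∸ x) ⊓ suc x
cdist-last k x x< = cong₂ _⊓_ e (trans (cong (suc (suc k) ∸_) e)
                                      (trans (+-∸-assoc 1 (m∸n≤m (suc k) x)) (cong suc (m∸[m∸n]≡n (s≤s⁻¹ x<)))))
  where
  e : ∣ x - suc k ∣ ≡ suc k ∸ x
  e = m≤n⇒∣m-n∣≡n∸m (s≤s⁻¹ x<)

cdist-wrap-≤ : ∀ k x → x < suc (suc k) → cdist (suc (suc k)) x 0 ≤ suc (cdist (suc (suc k)) x (suc k))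
cdist-wrap-≤ k x x< rewrite cdist-last k x x< | ∣-∣-identityʳ x =
  ⊓-swap-≤-suc x (suc (suc k) ∸ x) (suc k ∸ x) (suc x) (m≤n⇒m≤1+n (n≤1+n x)) (≤-reflexive (+-∸-assoc 1 (s≤s⁻¹ x<)))

cdist-wrap-≥ : ∀ k x → x < suc (suc k) → cdist (suc (suc k)) x (suc k) ≤ suc (cdist (suc (suc k)) x 0)
cdist-wrap-≥ k x x< rewrite cdist-last k x x< | ∣-∣-identityʳ x =
  ⊓-swap-≤-suc (suc k ∸ x) (suc x) x (suc (suc k) ∸ x) (≤-trans (∸-monoˡ-≤ x (n≤1+n (suc k))) (n≤1+n _)) ≤-refl

cdist-+ʳ-≤ : ∀ m x y d → x < m → y + d < m → cdist m x (y + d) ≤ d + cdist m x y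
cdist-+ʳ-≤ m x y zero    x< lt rewrite +-identityʳ y = ≤-refl
cdist-+ʳ-≤ m x y (suc d) x< lt rewrite +-suc y d =
  ≤-trans (cdist-sucʳ-≤ m x (y + d) x< lt) (s≤s (cdist-+ʳ-≤ m x y d x< (<-trans (n<1+n _) lt)))

cdist-+ʳ-≥ : ∀ m x y d → x < m → y + d < m → cdist m x y ≤ d + cdist m x (y + d)
cdist-+ʳ-≥ m x y zero    x< lt rewrite +-identityʳ y = ≤-refl
cdist-+ʳ-≥ m x y (suc d) x< lt rewrite +-suc y d =
  ≤-trans (cdist-+ʳ-≥ m x y d x< (<-trans (n<1+n _) lt))
          (≤-trans (+-monoʳ-≤ d (cdist-sucʳ-≥ m x (y + d) x< lt)) (≤-reflexive (+-suc d _)))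

-- σ m = ⌊m²/4⌋ is the transmission of a vertex of C_m.
σ : ℕ → ℕ
σ m = ∑ (cdist m 0) m

σ-+2 : ∀ m → σ (suc (suc m)) ≡ σ m + suc m
σ-+2 m = begin
  ∑ (cdist (2 + m) 0) (2 + m)                                             ≡⟨ ∑-sucˡ (cdist (2 + m) 0) (suc m) ⟩
  ∑ (λ k → cdist (2 + m) 0 (suc k)) m + cdist (2 + m) 0 (suc m)           ≡⟨ cong₂ _+_ (∑-cong _ _ m (λ k k< → inner k (<⇒≤ k<))) last ⟩
  ∑ (λ k → 1 + cdist m 0 k) m + 1                                         ≡⟨ cong (_+ 1) (∑-distrib (λ _ → 1) (cdist m 0) m) ⟩
  ∑ (λ _ → 1) m + σ m + 1                                                 ≡⟨ cong (λ z → z + σ m + 1) (trans (∑-const 1 m) (*-identityʳ m)) ⟩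
  m + σ m + 1                                                             ≡⟨ rearrange m (σ m) ⟩
  σ m + suc m                                                             ∎
  where
  inner : ∀ k → k ≤ m → cdist (2 + m) 0 (suc k) ≡ 1 + cdist m 0 k
  inner k k≤ = cong (suc k ⊓_) (+-∸-assoc 1 k≤)
  last : cdist (2 + m) 0 (suc m) ≡ 1
  last = trans (cong (suc m ⊓_) (trans (+-∸-assoc 1 (≤-refl {m})) (cong suc (n∸n≡0 m)))) (cong suc (⊓-zeroʳ m))
  rearrange : ∀ m s → m + s + 1 ≡ s + suc m
  rearrange = solve-∀

σ-even : ∀ k → σ (k + k) ≡ k * k
σ-even zero    = refl
σ-even (suc k) = begin
  σ (suc (k + suc k))     ≡⟨ cong (σ ∘ suc) (+-suc k k) ⟩
  σ (2 + (k + k))         ≡⟨ σ-+2 (k + k) ⟩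
  σ (k + k) + suc (k + k) ≡⟨ cong (_+ suc (k + k)) (σ-even k) ⟩
  k * k + suc (k + k)     ≡⟨ square k ⟩
  suc k * suc k           ∎
  where
  square : ∀ k → k * k + suc (k + k) ≡ suc k * suc k
  square = solve-∀

σ-odd : ∀ k → σ (suc (k + k)) ≡ k * k + k
σ-odd zero    = refl
σ-odd (suc k) = begin
  σ (2 + (k + suc k))         ≡⟨ cong (σ ∘ suc ∘ suc) (+-suc k k) ⟩
  σ (3 + (k + k))             ≡⟨ σ-+2 (suc (k + k)) ⟩
  σ (1 + (k + k)) + (2 + (k + k)) ≡⟨ cong (_+ (2 + (k + k))) (σ-odd k) ⟩
  k * k + k + (2 + (k + k))   ≡⟨ square k ⟩
  suc k * suc k + suc k       ∎
  where
  square : ∀ k → k * k + k + (2 + (k + k)) ≡ suc k * suc k + suc k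
  square = solve-∀

∑-cdist≡σ : ∀ m x → x ≤ m → ∑ (cdist m x) m ≡ σ m
∑-cdist≡σ m x x≤ = begin
  ∑ (cdist m x) m                                              ≡⟨ cong (∑ (cdist m x)) (m+[n∸m]≡n x≤) ⟨
  ∑ (cdist m x) (x + (m ∸ x))                                  ≡⟨ ∑-+ (cdist m x) x (m ∸ x) ⟩
  ∑ (cdist m x) x + ∑ (λ i → cdist m x (x + i)) (m ∸ x)        ≡⟨ cong₂ _+_ (sym (∑-reverse (cdist m x) x))
                                                                          (∑-cong _ _ (m ∸ x) (λ k _ → cdist-shift m x k)) ⟩
  ∑ (λ j → cdist m x (x ∸ suc j)) x + ∑ d₀ (m ∸ x)              ≡⟨ cong (_+ ∑ d₀ (m ∸ x)) (∑-cong _ _ x before) ⟩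
  ∑ (λ j → d₀ ((m ∸ x) + (x ∸ suc j))) x + ∑ d₀ (m ∸ x)         ≡⟨ cong (_+ ∑ d₀ (m ∸ x)) (∑-reverse (λ t → d₀ ((m ∸ x) + t)) x) ⟩
  ∑ (λ t → d₀ ((m ∸ x) + t)) x + ∑ d₀ (m ∸ x)                   ≡⟨ +-comm _ (∑ d₀ (m ∸ x)) ⟩
  ∑ d₀ (m ∸ x) + ∑ (λ t → d₀ ((m ∸ x) + t)) x                   ≡⟨ ∑-+ d₀ (m ∸ x) x ⟨
  ∑ d₀ ((m ∸ x) + x)                                           ≡⟨ cong (∑ d₀) (m∸n+n≡m x≤) ⟩
  σ m                                                          ∎
  where
  d₀ : ℕ → ℕ
  d₀ = cdist m 0
  before : ∀ j → j < x → cdist m x (x ∸ suc j) ≡ d₀ ((m ∸ x) + (x ∸ suc j))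
  before j j< = begin
    cdist m x (x ∸ suc j)            ≡⟨ cong (λ z → z ⊓ (m ∸ z)) (trans (∣-∣-comm x (x ∸ suc j))
                                          (trans (m≤n⇒∣m-n∣≡n∸m (m∸n≤m x (suc j))) (m∸[m∸n]≡n j<))) ⟩
    suc j ⊓ (m ∸ suc j)              ≡⟨ ⊓-comm _ _ ⟩
    (m ∸ suc j) ⊓ suc j              ≡⟨ cong ((m ∸ suc j) ⊓_) (m∸[m∸n]≡n (≤-trans j< x≤)) ⟨
    d₀ (m ∸ suc j)                   ≡⟨ cong d₀ (trans (sym (+-∸-assoc (m ∸ x) j<)) (cong (_∸ suc j) (m∸n+n≡m x≤))) ⟨
    d₀ ((m ∸ x) + (x ∸ suc j))       ∎

+⊓+-monoʳ-suc : ∀ p q a a' c c' → a' ≤ suc a → c' ≤ suc c → (p + a') ⊓ (q + c') ≤ suc ((p + a) ⊓ (q + c))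
+⊓+-monoʳ-suc p q a a' c c' h1 h2 = ⊓-mono-≤ (≤-trans (+-monoʳ-≤ p h1) (≤-reflexive (+-suc p a))) (≤-trans (+-monoʳ-≤ q h2) (≤-reflexive (+-suc q c)))

+⊓+-monoˡ-suc : ∀ p p' q q' a c → p' ≤ suc p → q' ≤ suc q → (p' + a) ⊓ (q' + c) ≤ suc ((p + a) ⊓ (q + c))
+⊓+-monoˡ-suc p p' q q' a c h1 h2 = ⊓-mono-≤ (+-monoˡ-≤ a h1) (+-monoˡ-≤ c h2)

⊓-corner : ∀ a a' c c' → a ≤ a' → c ≤ c' → (a' ⊓ c) ⊓ (a ⊓ c') ≡ a ⊓ c
⊓-corner a a' c c' h1 h2 = ≤-antisym
  (⊓-glb (≤-trans (m⊓n≤n _ _) (m⊓n≤m a c')) (≤-trans (m⊓n≤m _ _) (m⊓n≤n a' c)))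
  (⊓-glb (⊓-mono-≤ h1 ≤-refl) (⊓-mono-≤ ≤-refl h2))

∑-cdist-0⊓1 : ∀ b' → ∑ (λ y → cdist (suc b') 0 y ⊓ cdist (suc b') 1 y) (suc b') ≡ σ b'
∑-cdist-0⊓1 b' = trans (∑-sucˡ _ b') (∑-cong _ _ b' (λ s s< → e s (s≤s⁻¹ (m≤n⇒m≤1+n s<))))
  where
  e : ∀ s → s ≤ b' → cdist (suc b') 0 (suc s) ⊓ cdist (suc b') 1 (suc s) ≡ cdist b' 0 s
  e s s≤ = ⊓-corner s (suc s) (b' ∸ s) (suc b' ∸ s) (n≤1+n s) (∸-monoˡ-≤ s (n≤1+n b'))

∑-cdist-0⊓2 : ∀ b'' → ∑ (λ y → cdist (suc (suc b'')) 0 y ⊓ cdist (suc (suc b'')) 2 y) (suc (suc b'')) ≡ 1 + σ b''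
∑-cdist-0⊓2 b'' = trans (∑-sucˡ _ (suc b'')) (trans (∑-sucˡ _ b'') (cong suc (∑-cong _ _ b'' (λ s s< → e s))))
  where
  e : ∀ s → cdist (suc (suc b'')) 0 (suc (suc s)) ⊓ cdist (suc (suc b'')) 2 (suc (suc s)) ≡ cdist b'' 0 s
  e s = ⊓-corner s (suc (suc s)) (b'' ∸ s) (suc (suc b'') ∸ s) (≤-trans (n≤1+n s) (n≤1+n _)) (∸-monoˡ-≤ s (≤-trans (n≤1+n b'') (n≤1+n _)))

-- A cycle of G, listed as c 0, …, c m', realises the cycle metric

m≡n+o⇒m∸n≡o : ∀ m n o → m ≡ n + o → m ∸ n ≡ o
m≡n+o⇒m∸n≡o m n o refl = m+n∸m≡n n o

∸-suc : ∀ c k → suc k ≤ c → c ∸ k ≡ suc (c ∸ suc k)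
∸-suc (suc c) k (s≤s le) = +-∸-assoc 1 le

module EmbeddedCycle (G : Graph) (m' : ℕ) (c : ℕ → ℕ)
  (c<n : ∀ k → k ≤ m' → c k < order G)
  (c-edge : ∀ k → k < m' → adj G (c k) (c (suc k)) ≡ true)
  (c-wrap : adj G (c m') (c 0) ≡ true)
  (adj-sym : ∀ u v → adj G u v ≡ true → adj G v u ≡ true) where

  open Walks G

  reach-forward : ∀ x d → x + d ≤ m' → Reach d (c x) (c (x + d))
  reach-forward x zero    lt rewrite +-identityʳ x = reach-refl (c x)
  reach-forward x (suc d) lt rewrite +-suc x d =
    reach-step d (c x) (c (x + d)) (c (suc (x + d))) (c<n (x + d) (<⇒≤ lt)) (reach-forward x d (<⇒≤ lt)) (c-edge (x + d) lt)

  reach-backward : ∀ x d → x + d ≤ m' → Reach d (c (x + d)) (c x)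
  reach-backward x zero    lt rewrite +-identityʳ x = reach-refl (c x)
  reach-backward x (suc d) lt rewrite +-suc x d =
    reach-trans 1 d (c (suc (x + d))) (c (x + d)) (c x)
      (reach-edge _ _ (c<n (suc (x + d)) lt) (adj-sym _ _ (c-edge (x + d) lt))) (reach-backward x d (<⇒≤ lt))

  -- Either the direct arc of length d or the arc of length (m'+1) ∸ d through the edge c m' — c 0.
  reach-cdist-up : ∀ x d → x + d ≤ m' → Reach (cdist (suc m') x (x + d)) (c x) (c (x + d))
  reach-cdist-up x d le with ⊓-sel d (suc m' ∸ d)
  ... | inj₁ e = subst (λ k → Reach k (c x) (c (x + d))) (sym (trans (cdist-shift (suc m') x d) e)) (reach-forward x d le)
  ... | inj₂ e = subst (λ k → Reach k (c x) (c (x + d))) (sym (trans (cdist-shift (suc m') x d) (trans e around)))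
          (reach-trans (x + 1) rest (c x) (c m') (c (x + d))
            (reach-trans x 1 (c x) (c 0) (c m') (reach-backward 0 x (≤-trans (m≤m+n x d) le)) (reach-edge _ _ (c<n 0 z≤n) (adj-sym _ _ c-wrap)))
            (subst (λ z → Reach rest (c z) (c (x + d))) split (reach-backward (x + d) rest (≤-reflexive split))))
    where
    rest = m' ∸ (x + d)
    split : x + d + rest ≡ m'
    split = m+[n∸m]≡n le
    around : suc m' ∸ d ≡ x + 1 + rest
    around = m≡n+o⇒m∸n≡o (suc m') d (x + 1 + rest) (trans (cong suc (sym split)) (arith x d rest))
      where
      arith : ∀ x d e → suc (x + d + e) ≡ d + (x + 1 + e)
      arith = solve-∀

  reach-cdist-down : ∀ y d → y + d ≤ m' → Reach (cdist (suc m') (y + d) y) (c (y + d)) (c y)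
  reach-cdist-down y d le with ⊓-sel d (suc m' ∸ d)
  ... | inj₁ e = subst (λ k → Reach k (c (y + d)) (c y)) (sym (trans (cdist-sym (suc m') (y + d) y) (trans (cdist-shift (suc m') y d) e)))
                   (reach-backward y d le)
  ... | inj₂ e = subst (λ k → Reach k (c (y + d)) (c y)) (sym (trans (cdist-sym (suc m') (y + d) y) (trans (cdist-shift (suc m') y d) (trans e around))))
          (reach-trans (rest + 1) y (c (y + d)) (c 0) (c y)
            (reach-trans rest 1 (c (y + d)) (c m') (c 0)
              (subst (λ z → Reach rest (c (y + d)) (c z)) split (reach-forward (y + d) rest (≤-reflexive split))) (reach-edge _ _ (c<n m' ≤-refl) c-wrap))
            (reach-forward 0 y (≤-trans (m≤m+n y d) le)))
    where
    rest = m' ∸ (y + d)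
    split : y + d + rest ≡ m'
    split = m+[n∸m]≡n le
    around : suc m' ∸ d ≡ rest + 1 + y
    around = m≡n+o⇒m∸n≡o (suc m') d (rest + 1 + y) (trans (cong suc (sym split)) (arith y d rest))
      where
      arith : ∀ y d e → suc (y + d + e) ≡ d + (e + 1 + y)
      arith = solve-∀

  reach-cdist : ∀ x y → x ≤ m' → y ≤ m' → Reach (cdist (suc m') x y) (c x) (c y)
  reach-cdist x y x≤ y≤ with ≤-total x y
  ... | inj₁ x≤y = subst (λ z → Reach (cdist (suc m') x z) (c x) (c z)) (m+[n∸m]≡n x≤y)
                         (reach-cdist-up x (y ∸ x) (subst (_≤ m') (sym (m+[n∸m]≡n x≤y)) y≤))
  ... | inj₂ y≤x = subst (λ z → Reach (cdist (suc m') z y) (c z) (c y)) (m+[n∸m]≡n y≤x)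
                         (reach-cdist-down y (x ∸ y) (subst (_≤ m') (sym (m+[n∸m]≡n y≤x)) x≤))

-- Edge lists

edgeIn-∷⁻ : ∀ a b es u v → edgeIn ((a , b) ∷ es) u v ≡ true → ((a ≡ u × b ≡ v) ⊎ (a ≡ v × b ≡ u)) ⊎ edgeIn es u v ≡ true
edgeIn-∷⁻ a b es u v e with ∨-true⁻ (((a ≡ᵇ u) ∧ (b ≡ᵇ v)) ∨ ((a ≡ᵇ v) ∧ (b ≡ᵇ u))) _ e
... | inj₂ e₂ = inj₂ e₂
... | inj₁ e₁ with ∨-true⁻ ((a ≡ᵇ u) ∧ (b ≡ᵇ v)) _ e₁
...   | inj₁ e₃ with ∧-true⁻ (a ≡ᵇ u) _ e₃
...     | p , q = inj₁ (inj₁ (≡ᵇ-true⇒≡ a u p , ≡ᵇ-true⇒≡ b v q))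
edgeIn-∷⁻ a b es u v e | inj₁ e₁ | inj₂ e₃ with ∧-true⁻ (a ≡ᵇ v) _ e₃
...     | p , q = inj₁ (inj₂ (≡ᵇ-true⇒≡ a v p , ≡ᵇ-true⇒≡ b u q))

edgeIn-here : ∀ es u v → edgeIn ((u , v) ∷ es) u v ≡ true
edgeIn-here es u v rewrite ≡ᵇ-refl u | ≡ᵇ-refl v = refl

edgeIn-here-flipped : ∀ es u v → edgeIn ((v , u) ∷ es) u v ≡ true
edgeIn-here-flipped es u v rewrite ≡ᵇ-refl u | ≡ᵇ-refl v = ∨-true⁺ˡ _ (∨-true⁺ʳ ((v ≡ᵇ u) ∧ (u ≡ᵇ v)) refl)

edgeIn-there : ∀ e es u v → edgeIn es u v ≡ true → edgeIn (e ∷ es) u v ≡ true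
edgeIn-there (a , b) es u v h = ∨-true⁺ʳ (((a ≡ᵇ u) ∧ (b ≡ᵇ v)) ∨ ((a ≡ᵇ v) ∧ (b ≡ᵇ u))) h

edgeIn-++ˡ : ∀ xs ys u v → edgeIn xs u v ≡ true → edgeIn (xs ++ ys) u v ≡ true
edgeIn-++ˡ ((a , b) ∷ xs) ys u v h with edgeIn-∷⁻ a b xs u v h
... | inj₁ (inj₁ (refl , refl)) = edgeIn-here (xs ++ ys) u v
... | inj₁ (inj₂ (refl , refl)) = edgeIn-here-flipped (xs ++ ys) u v
... | inj₂ h'                   = edgeIn-there (a , b) (xs ++ ys) u v (edgeIn-++ˡ xs ys u v h')

edgeIn-++ʳ : ∀ xs ys u v → edgeIn ys u v ≡ true → edgeIn (xs ++ ys) u v ≡ true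
edgeIn-++ʳ []       ys u v h = h
edgeIn-++ʳ (e ∷ xs) ys u v h = edgeIn-there e (xs ++ ys) u v (edgeIn-++ʳ xs ys u v h)

edgeIn-++⁻ : ∀ xs ys u v → edgeIn (xs ++ ys) u v ≡ true → edgeIn xs u v ≡ true ⊎ edgeIn ys u v ≡ true
edgeIn-++⁻ []             ys u v h = inj₂ h
edgeIn-++⁻ ((a , b) ∷ xs) ys u v h with edgeIn-∷⁻ a b (xs ++ ys) u v h
... | inj₁ (inj₁ (refl , refl)) = inj₁ (edgeIn-here xs u v)
... | inj₁ (inj₂ (refl , refl)) = inj₁ (edgeIn-here-flipped xs u v)
... | inj₂ h' with edgeIn-++⁻ xs ys u v h'
...   | inj₁ h₁ = inj₁ (edgeIn-there (a , b) xs u v h₁)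
...   | inj₂ h₂ = inj₂ h₂

edgeIn-sym : ∀ es u v → edgeIn es u v ≡ true → edgeIn es v u ≡ true
edgeIn-sym [] u v ()
edgeIn-sym ((a , b) ∷ es) u v h with edgeIn-∷⁻ a b es u v h
... | inj₁ (inj₁ (refl , refl)) = edgeIn-here-flipped es v u
... | inj₁ (inj₂ (refl , refl)) = edgeIn-here es v u
... | inj₂ h'                   = edgeIn-there (a , b) es v u (edgeIn-sym es u v h')

arcEdges : ℕ → ℕ → ℕ → ℕ → List (ℕ × ℕ)
arcEdges x s m y = pathEdges (x ∷ (range s m ++ y ∷ []))

data ArcEdge (x s m y : ℕ) : ℕ → ℕ → Set where
  direct : m ≡ 0 → ArcEdge x s m y x y
  first  : 1 ≤ m → ArcEdge x s m y x s
  inner  : ∀ k → suc k < m → ArcEdge x s m y (s + k) (suc (s + k))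
  last   : ∀ j → m ≡ suc j → ArcEdge x s m y (s + j) y

arcEdge-tail : ∀ {x s m y a c} → ArcEdge s (suc s) m y a c → ArcEdge x s (suc m) y a c
arcEdge-tail {x} {s} {m} {y} (direct refl) = subst (λ z → ArcEdge x s 1 y z y) (+-identityʳ s) (last 0 refl)
arcEdge-tail {x} {s} {m} {y} (first 1≤m)   = subst₂ (ArcEdge x s (suc m) y) (+-identityʳ s) (cong suc (+-identityʳ s)) (inner 0 (s≤s 1≤m))
arcEdge-tail {x} {s} {m} {y} (inner k k<)  = subst₂ (ArcEdge x s (suc m) y) (+-suc s k) (cong suc (+-suc s k)) (inner (suc k) (s≤s k<))
arcEdge-tail {x} {s} {m} {y} (last j refl) = subst (λ z → ArcEdge x s (suc m) y z y) (+-suc s j) (last (suc j) refl)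

arcEdge⁻ : ∀ x s m y u v → edgeIn (arcEdges x s m y) u v ≡ true → ArcEdge x s m y u v ⊎ ArcEdge x s m y v u
arcEdge⁻ x s zero y u v h with edgeIn-∷⁻ x y [] u v h
... | inj₁ (inj₁ (refl , refl)) = inj₁ (direct refl)
... | inj₁ (inj₂ (refl , refl)) = inj₂ (direct refl)
arcEdge⁻ x s (suc m) y u v h with edgeIn-∷⁻ x s (arcEdges s (suc s) m y) u v h
... | inj₁ (inj₁ (refl , refl)) = inj₁ (first (s≤s z≤n))
... | inj₁ (inj₂ (refl , refl)) = inj₂ (first (s≤s z≤n))
... | inj₂ h' with arcEdge⁻ s (suc s) m y u v h'
...   | inj₁ e = inj₁ (arcEdge-tail e)
...   | inj₂ e = inj₂ (arcEdge-tail e)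

arcEdges-direct : ∀ x s y → edgeIn (arcEdges x s 0 y) x y ≡ true
arcEdges-direct x s y = edgeIn-here [] x y

arcEdges-first : ∀ x s m y → 1 ≤ m → edgeIn (arcEdges x s m y) x s ≡ true
arcEdges-first x s (suc m) y _ = edgeIn-here (arcEdges s (suc s) m y) x s

arcEdges-inner : ∀ x s m y k → suc k < m → edgeIn (arcEdges x s m y) (s + k) (suc (s + k)) ≡ true
arcEdges-inner x s (suc m) y zero (s≤s 1≤m) rewrite +-identityʳ s =
  edgeIn-there (x , s) (arcEdges s (suc s) m y) s (suc s) (arcEdges-first s (suc s) m y 1≤m)
arcEdges-inner x s (suc m) y (suc k) (s≤s k<) rewrite +-suc s k =
  edgeIn-there (x , s) (arcEdges s (suc s) m y) (suc (s + k)) (suc (suc (s + k))) (arcEdges-inner s (suc s) m y k k<)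

arcEdges-last : ∀ x s j y → edgeIn (arcEdges x s (suc j) y) (s + j) y ≡ true
arcEdges-last x s zero y rewrite +-identityʳ s =
  edgeIn-there (x , s) (arcEdges s (suc s) 0 y) s y (arcEdges-direct s (suc s) y)
arcEdges-last x s (suc j) y rewrite +-suc s j =
  edgeIn-there (x , s) (arcEdges s (suc s) (suc j) y) (suc (s + j)) y (arcEdges-last s (suc s) j y)

edgeIn-++₃⁻ : ∀ xs ys zs u v → edgeIn (xs ++ ys ++ zs) u v ≡ true →
  edgeIn xs u v ≡ true ⊎ edgeIn ys u v ≡ true ⊎ edgeIn zs u v ≡ true
edgeIn-++₃⁻ xs ys zs u v h with edgeIn-++⁻ xs (ys ++ zs) u v h
... | inj₁ h₁ = inj₁ h₁
... | inj₂ h' = inj₂ (edgeIn-++⁻ ys zs u v h')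

edgeIn-++₃-second : ∀ xs ys zs u v → edgeIn ys u v ≡ true → edgeIn (xs ++ ys ++ zs) u v ≡ true
edgeIn-++₃-second xs ys zs u v h = edgeIn-++ʳ xs (ys ++ zs) u v (edgeIn-++ˡ ys zs u v h)

edgeIn-++₃-third : ∀ xs ys zs u v → edgeIn zs u v ≡ true → edgeIn (xs ++ ys ++ zs) u v ≡ true
edgeIn-++₃-third xs ys zs u v h = edgeIn-++ʳ xs (ys ++ zs) u v (edgeIn-++ʳ ys zs u v h)
-- The model theta graph on positions 0, …, n - 1. Positions 0, …, b' form the cycle C_b, b = b' + 1, and
-- b' + 1, …, b' + l are the inner vertices of an ear of length ℓ = l + 1 from position 0 to position δ. The ear
-- and the arc 0, …, δ form a cycle C_E, E = ℓ + δ, in which ear vertex b' + i has index i and position δ index ℓ;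
-- α i and β i are its distances to the two ends of the ear.
module ThetaModel (b'' l δ' : ℕ) (1≤l : 1 ≤ l) (δ≤ℓ : δ' ≤ l) (2δ≤b : suc δ' + suc δ' ≤ suc (suc b'')) where
  b' = suc b''
  b = suc b'
  ℓ = suc l
  δ = suc δ'
  E = suc (suc (l + δ'))
  n = b + l

  E≡ : E ≡ ℓ + δ
  E≡ = cong suc (sym (+-suc l δ'))

  δ≤b' : δ ≤ b'
  δ≤b' = ≤-trans (m≤n+m (suc δ') δ') (s≤s⁻¹ 2δ≤b)

  ℓ<E : ℓ < E
  ℓ<E = s≤s (s≤s (m≤m+n l δ'))

  α β : ℕ → ℕ
  α i = cdist E i 0
  β i = cdist E i ℓ

  earToCycle : ℕ → ℕ → ℕ
  earToCycle i y = (α i + cdist b 0 y) ⊓ (β i + cdist b δ y)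

  cdist-0δ : cdist b 0 δ ≡ δ
  cdist-0δ = m≤n⇒m⊓n≡m (m+n≤o⇒m≤o∸n δ 2δ≤b)

  cdist-δ0 : cdist b δ 0 ≡ δ
  cdist-δ0 = trans (cdist-sym b δ 0) cdist-0δ

  E∸ℓ : E ∸ ℓ ≡ δ
  E∸ℓ = m≡n+o⇒m∸n≡o E ℓ δ E≡

  cdist-0ℓ : cdist E 0 ℓ ≡ δ
  cdist-0ℓ = trans (cong (ℓ ⊓_) E∸ℓ) (m≥n⇒m⊓n≡n (s≤s δ≤ℓ))

  cdist-ℓ0 : cdist E ℓ 0 ≡ δ
  cdist-ℓ0 = trans (cdist-sym E ℓ 0) cdist-0ℓ

  cdist₀≤δ+cdistδ : ∀ y → y < b → cdist b 0 y ≤ δ + cdist b δ y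
  cdist₀≤δ+cdistδ y y< rewrite cdist-sym b 0 y | cdist-sym b δ y = cdist-+ʳ-≥ b y 0 δ y< (s≤s δ≤b')

  cdistδ≤δ+cdist₀ : ∀ y → y < b → cdist b δ y ≤ δ + cdist b 0 y
  cdistδ≤δ+cdist₀ y y< rewrite cdist-sym b 0 y | cdist-sym b δ y = cdist-+ʳ-≤ b y 0 δ y< (s≤s δ≤b')

  α≤δ+β : ∀ i → i < E → α i ≤ δ + β i
  α≤δ+β i i< = ≤-trans (cdist-wrap-≤ (l + δ') i i<) (s≤s (cdist-+ʳ-≤ E i ℓ δ' i< ≤-refl))

  β≤δ+α : ∀ i → i < E → β i ≤ δ + α i
  β≤δ+α i i< = ≤-trans (cdist-+ʳ-≥ E i ℓ δ' i< ≤-refl) (≤-trans (+-monoʳ-≤ δ' (cdist-wrap-≥ (l + δ') i i<)) (≤-reflexive (+-suc δ' _)))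

  earToCycle-0 : ∀ y → y < b → earToCycle 0 y ≡ cdist b 0 y
  earToCycle-0 y y< rewrite cdist-self E 0 | cdist-0ℓ = m≤n⇒m⊓n≡m (cdist₀≤δ+cdistδ y y<)

  earToCycle-ℓ : ∀ y → y < b → earToCycle ℓ y ≡ cdist b δ y
  earToCycle-ℓ y y< rewrite cdist-self E ℓ | cdist-ℓ0 = m≥n⇒m⊓n≡n (cdistδ≤δ+cdist₀ y y<)

  earToCycle-at-0 : ∀ i → i < E → earToCycle i 0 ≡ α i
  earToCycle-at-0 i i< rewrite cdist-self b 0 | cdist-δ0 | +-identityʳ (α i) = m≤n⇒m⊓n≡m (≤-trans (α≤δ+β i i<) (≤-reflexive (+-comm δ (β i))))

  earToCycle-at-δ : ∀ i → i < E → earToCycle i δ ≡ β i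
  earToCycle-at-δ i i< rewrite cdist-0δ | cdist-self b δ | +-identityʳ (β i) = m≥n⇒m⊓n≡n (≤-trans (β≤δ+α i i<) (≤-reflexive (+-comm δ (α i))))

  earToCycle-sucˡ-≤ : ∀ i y → suc i < E → y < b → earToCycle (suc i) y ≤ suc (earToCycle i y)
  earToCycle-sucˡ-≤ i y si< y< = +⊓+-monoˡ-suc (α i) (α (suc i)) (β i) (β (suc i)) _ _ (cdist-sucˡ-≤ E i 0 si< (s≤s z≤n)) (cdist-sucˡ-≤ E i ℓ si< ℓ<E)

  earToCycle-sucˡ-≥ : ∀ i y → suc i < E → y < b → earToCycle i y ≤ suc (earToCycle (suc i) y)
  earToCycle-sucˡ-≥ i y si< y< = +⊓+-monoˡ-suc (α (suc i)) (α i) (β (suc i)) (β i) _ _ (cdist-sucˡ-≥ E i 0 si< (s≤s z≤n)) (cdist-sucˡ-≥ E i ℓ si< ℓ<E)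

  earToCycle-sucʳ-≤ : ∀ i y → suc y < b → earToCycle i (suc y) ≤ suc (earToCycle i y)
  earToCycle-sucʳ-≤ i y sy< = +⊓+-monoʳ-suc (α i) (β i) _ _ _ _ (cdist-sucʳ-≤ b 0 y (s≤s z≤n) sy<) (cdist-sucʳ-≤ b δ y (s≤s δ≤b') sy<)

  earToCycle-sucʳ-≥ : ∀ i y → suc y < b → earToCycle i y ≤ suc (earToCycle i (suc y))
  earToCycle-sucʳ-≥ i y sy< = +⊓+-monoʳ-suc (α i) (β i) _ _ _ _ (cdist-sucʳ-≥ b 0 y (s≤s z≤n) sy<) (cdist-sucʳ-≥ b δ y (s≤s δ≤b') sy<)

  earToCycle-wrap-≤ : ∀ i → earToCycle i 0 ≤ suc (earToCycle i b')
  earToCycle-wrap-≤ i = +⊓+-monoʳ-suc (α i) (β i) _ _ _ _ (cdist-wrap-≤ b'' 0 (s≤s z≤n)) (cdist-wrap-≤ b'' δ (s≤s δ≤b'))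

  earToCycle-wrap-≥ : ∀ i → earToCycle i b' ≤ suc (earToCycle i 0)
  earToCycle-wrap-≥ i = +⊓+-monoʳ-suc (α i) (β i) _ _ _ _ (cdist-wrap-≥ b'' 0 (s≤s z≤n)) (cdist-wrap-≥ b'' δ (s≤s δ≤b'))

  data ModelEdge : ℕ → ℕ → Set where
    arc : ∀ k → k < b' → ModelEdge k (suc k)
    wrap : ModelEdge b' 0
    ear-first : ModelEdge 0 (b' + 1)
    ear-mid : ∀ i → 1 ≤ i → i < l → ModelEdge (b' + i) (b' + suc i)
    ear-last : ModelEdge (b' + l) δ

  θdist : ℕ → ℕ → ℕ
  θdist x y with x ≤? b' | y ≤? b'
  ... | yes _ | yes _ = cdist b x y
  ... | yes _ | no _ = earToCycle (y ∸ b') x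
  ... | no _ | yes _ = earToCycle (x ∸ b') y
  ... | no _ | no _ = cdist E (x ∸ b') (y ∸ b')

  ear≰b' : ∀ i → 1 ≤ i → ¬ (b' + i ≤ b')
  ear≰b' i 1≤i le = 1+n≰n (≤-trans (≤-trans (≤-reflexive (+-comm 1 b')) (+-monoʳ-≤ b' 1≤i)) le)

  θdist-cc : ∀ x y → x ≤ b' → y ≤ b' → θdist x y ≡ cdist b x y
  θdist-cc x y hx hy with x ≤? b' | y ≤? b'
  ... | yes _ | yes _ = refl
  ... | no ¬p | _ = ⊥-elim (¬p hx)
  ... | yes _ | no ¬p = ⊥-elim (¬p hy)

  θdist-ce : ∀ x j → x ≤ b' → 1 ≤ j → θdist x (b' + j) ≡ earToCycle j x
  θdist-ce x j hx hj with x ≤? b' | (b' + j) ≤? b'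
  ... | yes _ | no _ = cong (λ z → earToCycle z x) (m+n∸m≡n b' j)
  ... | no ¬p | _ = ⊥-elim (¬p hx)
  ... | yes _ | yes p = ⊥-elim (ear≰b' j hj p)

  θdist-ec : ∀ i y → 1 ≤ i → y ≤ b' → θdist (b' + i) y ≡ earToCycle i y
  θdist-ec i y hi hy with (b' + i) ≤? b' | y ≤? b'
  ... | no _ | yes _ = cong (λ z → earToCycle z y) (m+n∸m≡n b' i)
  ... | yes p | _ = ⊥-elim (ear≰b' i hi p)
  ... | no _ | no ¬p = ⊥-elim (¬p hy)

  θdist-ee : ∀ i j → 1 ≤ i → 1 ≤ j → θdist (b' + i) (b' + j) ≡ cdist E i j
  θdist-ee i j hi hj with (b' + i) ≤? b' | (b' + j) ≤? b'
  ... | no _ | no _ = cong₂ (cdist E) (m+n∸m≡n b' i) (m+n∸m≡n b' j)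
  ... | yes p | _ = ⊥-elim (ear≰b' i hi p)
  ... | no _ | yes p = ⊥-elim (ear≰b' j hj p)

  data Position : ℕ → Set where
    onCycle : ∀ x → x ≤ b' → Position x
    onEar : ∀ i → 1 ≤ i → i ≤ l → Position (b' + i)

  position : ∀ x → x < n → Position x
  position x x< with x ≤? b'
  ... | yes p = onCycle x p
  ... | no ¬p = subst Position e (onEar (x ∸ b') (m+n≤o⇒m≤o∸n 1 (≰⇒> ¬p)) i≤l)
    where
    e : b' + (x ∸ b') ≡ x
    e = m+[n∸m]≡n (<⇒≤ (≰⇒> ¬p))
    i≤l : x ∸ b' ≤ l
    i≤l = ≤-trans (∸-monoˡ-≤ b' (s≤s⁻¹ x<)) (≤-reflexive (m+n∸m≡n b' l))

  1+ear<E : ∀ i → i ≤ l → suc i < E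
  1+ear<E i i≤ = s≤s (s≤s (≤-trans i≤ (m≤m+n l δ')))

  ear<E : ∀ i → i ≤ l → i < E
  ear<E i i≤ = <-trans (n<1+n i) (1+ear<E i i≤)

  within-one-cong : ∀ {p q p' q'} → p ≡ p' → q ≡ q' → (q' ≤ suc p' × p' ≤ suc q') → (q ≤ suc p × p ≤ suc q)
  within-one-cong refl refl h = h

  θdist-step : ∀ x p p' → x < n → ModelEdge p p' → θdist x p' ≤ suc (θdist x p) × θdist x p ≤ suc (θdist x p')
  θdist-step x p p' x< ae with position x x<
  θdist-step x .k .(suc k) x< (arc k k<) | onCycle .x hx =
    within-one-cong (θdist-cc x k hx (<⇒≤ k<)) (θdist-cc x (suc k) hx k<) (cdist-sucʳ-≤ b x k (s≤s hx) (s≤s k<) , cdist-sucʳ-≥ b x k (s≤s hx) (s≤s k<))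
  θdist-step x .b' .0 x< wrap | onCycle .x hx =
    within-one-cong (θdist-cc x b' hx ≤-refl) (θdist-cc x 0 hx z≤n) (cdist-wrap-≤ b'' x (s≤s hx) , cdist-wrap-≥ b'' x (s≤s hx))
  θdist-step x .0 .(b' + 1) x< ear-first | onCycle .x hx =
    within-one-cong (trans (θdist-cc x 0 hx z≤n) (trans (cdist-sym b x 0) (sym (earToCycle-0 x (s≤s hx))))) (θdist-ce x 1 hx ≤-refl)
      (earToCycle-sucˡ-≤ 0 x (1+ear<E 0 z≤n) (s≤s hx) , earToCycle-sucˡ-≥ 0 x (1+ear<E 0 z≤n) (s≤s hx))
  θdist-step x .(b' + i) .(b' + suc i) x< (ear-mid i hi il) | onCycle .x hx =
    within-one-cong (θdist-ce x i hx hi) (θdist-ce x (suc i) hx (s≤s z≤n)) (earToCycle-sucˡ-≤ i x (1+ear<E i (<⇒≤ il)) (s≤s hx) , earToCycle-sucˡ-≥ i x (1+ear<E i (<⇒≤ il)) (s≤s hx))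
  θdist-step x .(b' + l) .δ x< ear-last | onCycle .x hx =
    within-one-cong (θdist-ce x l hx 1≤l) (trans (θdist-cc x δ hx δ≤b') (trans (cdist-sym b x δ) (sym (earToCycle-ℓ x (s≤s hx)))))
      (earToCycle-sucˡ-≤ l x (1+ear<E l ≤-refl) (s≤s hx) , earToCycle-sucˡ-≥ l x (1+ear<E l ≤-refl) (s≤s hx))
  θdist-step .(b' + i) .k .(suc k) x< (arc k k<) | onEar i hi hil =
    within-one-cong (θdist-ec i k hi (<⇒≤ k<)) (θdist-ec i (suc k) hi k<) (earToCycle-sucʳ-≤ i k (s≤s k<) , earToCycle-sucʳ-≥ i k (s≤s k<))
  θdist-step .(b' + i) .b' .0 x< wrap | onEar i hi hil =
    within-one-cong (θdist-ec i b' hi ≤-refl) (θdist-ec i 0 hi z≤n) (earToCycle-wrap-≤ i , earToCycle-wrap-≥ i)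
  θdist-step .(b' + i) .0 .(b' + 1) x< ear-first | onEar i hi hil =
    within-one-cong (trans (θdist-ec i 0 hi z≤n) (earToCycle-at-0 i (ear<E i hil))) (θdist-ee i 1 hi ≤-refl)
      (cdist-sucʳ-≤ E i 0 (ear<E i hil) (1+ear<E 0 z≤n) , cdist-sucʳ-≥ E i 0 (ear<E i hil) (1+ear<E 0 z≤n))
  θdist-step .(b' + i) .(b' + j) .(b' + suc j) x< (ear-mid j hj jl) | onEar i hi hil =
    within-one-cong (θdist-ee i j hi hj) (θdist-ee i (suc j) hi (s≤s z≤n)) (cdist-sucʳ-≤ E i j (ear<E i hil) (1+ear<E j (<⇒≤ jl)) , cdist-sucʳ-≥ E i j (ear<E i hil) (1+ear<E j (<⇒≤ jl)))
  θdist-step .(b' + i) .(b' + l) .δ x< ear-last | onEar i hi hil =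
    within-one-cong (θdist-ee i l hi 1≤l) (trans (θdist-ec i δ hi δ≤b') (earToCycle-at-δ i (ear<E i hil)))
      (cdist-sucʳ-≤ E i l (ear<E i hil) (1+ear<E l ≤-refl) , cdist-sucʳ-≥ E i l (ear<E i hil) (1+ear<E l ≤-refl))

  θdist-self : ∀ x → x < n → θdist x x ≡ 0
  θdist-self x x< with position x x<
  ... | onCycle .x hx = trans (θdist-cc x x hx hx) (cdist-self b x)
  ... | onEar i hi _ = trans (θdist-ee i i hi hi) (cdist-self E i)

  θdist-sym : ∀ x y → x < n → y < n → θdist x y ≡ θdist y x
  θdist-sym x y x< y< with position x x< | position y y<
  ... | onCycle .x hx | onCycle .y hy = trans (θdist-cc x y hx hy) (trans (cdist-sym b x y) (sym (θdist-cc y x hy hx)))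
  ... | onCycle .x hx | onEar j hj _ = trans (θdist-ce x j hx hj) (sym (θdist-ec j x hj hx))
  ... | onEar i hi _ | onCycle .y hy = trans (θdist-ec i y hi hy) (sym (θdist-ce y i hy hi))
  ... | onEar i hi _ | onEar j hj _ = trans (θdist-ee i j hi hj) (trans (cdist-sym E i j) (sym (θdist-ee j i hj hi)))

  earToCycle≤n : ∀ i y → i ≤ l → earToCycle i y ≤ n
  earToCycle≤n i y il = ≤-trans (m⊓n≤m _ _) (≤-trans (+-mono-≤ α≤l (cdist≤m b 0 y)) (≤-reflexive (+-comm l b)))
    where
    α≤l : α i ≤ l
    α≤l = ≤-trans (cdist≤∣-∣ E i 0) (≤-trans (≤-reflexive (∣-∣-identityʳ i)) il)

  θdist≤n : ∀ x y → x < n → y < n → θdist x y ≤ n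
  θdist≤n x y x< y< with position x x< | position y y<
  ... | onCycle .x hx | onCycle .y hy = ≤-trans (≤-reflexive (θdist-cc x y hx hy)) (≤-trans (cdist≤m b x y) (m≤m+n b l))
  ... | onCycle .x hx | onEar j hj jl = ≤-trans (≤-reflexive (θdist-ce x j hx hj)) (earToCycle≤n j x jl)
  ... | onEar i hi il | onCycle .y hy = ≤-trans (≤-reflexive (θdist-ec i y hi hy)) (earToCycle≤n i y il)
  ... | onEar i hi il | onEar j hj jl = ≤-trans (≤-reflexive (θdist-ee i j hi hj))
                                          (≤-trans (cdist≤∣-∣ E i j) (≤-trans (≤-trans (∣m-n∣≤m⊔n i j) (⊔-lub il jl)) (m≤n+m l b)))

  earCycle : ℕ → ℕ
  earCycle zero = 0
  earCycle (suc k) with suc k ≤? l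
  ... | yes _ = b' + suc k
  ... | no _ = E ∸ suc k

  earCycle-ear : ∀ k → 1 ≤ k → k ≤ l → earCycle k ≡ b' + k
  earCycle-ear (suc k) _ kl with suc k ≤? l
  ... | yes _ = refl
  ... | no ¬p = ⊥-elim (¬p kl)

  earCycle-back : ∀ k → l < k → earCycle k ≡ E ∸ k
  earCycle-back (suc k) lk with suc k ≤? l
  ... | yes p = ⊥-elim (<-irrefl refl (≤-trans lk p))
  ... | no _ = refl

  module Realisation (G : Graph) (lab : ℕ → ℕ)
    (lab<n : ∀ x → x < n → lab x < order G)
    (model-edge⇒adj : ∀ p p' → ModelEdge p p' → adj G (lab p) (lab p') ≡ true)
    (adj-sym : ∀ u v → adj G u v ≡ true → adj G v u ≡ true) where

    open Walks G hiding (n)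

    cycle<n : ∀ k → k ≤ b' → k < n
    cycle<n k k≤ = s≤s (≤-trans k≤ (m≤m+n b' l))

    module Cycle = EmbeddedCycle G b' lab (λ k k≤ → lab<n k (cycle<n k k≤)) (λ k k< → model-edge⇒adj k (suc k) (arc k k<)) (model-edge⇒adj b' 0 wrap) adj-sym

    earCycle-ℓ : earCycle ℓ ≡ δ
    earCycle-ℓ = trans (earCycle-back ℓ ≤-refl) E∸ℓ

    earCycle<n : ∀ k → k ≤ suc (l + δ') → earCycle k < n
    earCycle<n zero _ = cycle<n 0 z≤n
    earCycle<n (suc k) k≤ with suc k ≤? l
    ... | yes p = s≤s (+-monoʳ-≤ b' p)
    ... | no ¬p = cycle<n _ (≤-trans (∸-monoʳ-≤ E (≰⇒> ¬p)) (≤-trans (≤-reflexive E∸ℓ) δ≤b'))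

    E∸suc : ∀ k → suc k ≤ E → E ∸ k ≡ suc (E ∸ suc k)
    E∸suc k le = +-∸-assoc 1 (s≤s⁻¹ le)

    earCycle-edge : ∀ k → k < suc (l + δ') → adj G (lab (earCycle k)) (lab (earCycle (suc k))) ≡ true
    earCycle-edge zero _ = subst (λ z → adj G (lab 0) (lab z) ≡ true) (sym (earCycle-ear 1 (s≤s z≤n) 1≤l)) (model-edge⇒adj 0 (b' + 1) ear-first)
    earCycle-edge (suc k) k< with <-cmp (suc k) l
    ... | tri< p _ _ = subst₂ (λ z w → adj G (lab z) (lab w) ≡ true) (sym (earCycle-ear (suc k) (s≤s z≤n) (<⇒≤ p))) (sym (earCycle-ear (suc (suc k)) (s≤s z≤n) p))
                    (model-edge⇒adj _ _ (ear-mid (suc k) (s≤s z≤n) p))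
    ... | tri≈ _ sk≡l _ = subst₂ (λ z w → adj G (lab z) (lab w) ≡ true)
                    (sym (trans (earCycle-ear (suc k) (s≤s z≤n) (≤-reflexive sk≡l)) (cong (b' +_) sk≡l)))
                    (sym (trans (earCycle-back (suc (suc k)) (s≤s (≤-reflexive (sym sk≡l)))) (trans (cong (λ z → E ∸ suc z) sk≡l) E∸ℓ)))
                    (model-edge⇒adj _ _ ear-last)
    ... | tri> _ _ lk = subst₂ (λ z w → adj G (lab z) (lab w) ≡ true) (sym (trans (earCycle-back (suc k) lk) (E∸suc (suc k) (m≤n⇒m≤1+n k<)))) (sym (earCycle-back (suc (suc k)) (<-trans lk (n<1+n _))))
                    (adj-sym _ _ (model-edge⇒adj _ _ (arc (E ∸ suc (suc k)) lt)))
      where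
      lt : E ∸ suc (suc k) < b'
      lt = ≤-trans (s≤s (∸-monoʳ-≤ E (s≤s lk))) (≤-trans (≤-reflexive (cong suc (m≡n+o⇒m∸n≡o E (suc ℓ) δ' refl))) δ≤b')

    earCycle-wrap : adj G (lab (earCycle (suc (l + δ')))) (lab (earCycle 0)) ≡ true
    earCycle-wrap = subst (λ z → adj G (lab z) (lab 0) ≡ true) (sym (trans (earCycle-back (suc (l + δ')) (s≤s (m≤m+n l δ'))) (m≡n+o⇒m∸n≡o E (suc (l + δ')) 1 (+-comm 1 (suc (l + δ'))))))
            (adj-sym _ _ (model-edge⇒adj 0 1 (arc 0 (≤-trans (s≤s z≤n) δ≤b'))))

    module EarCycle = EmbeddedCycle G (suc (l + δ')) (λ k → lab (earCycle k)) (λ k k≤ → lab<n _ (earCycle<n k k≤)) earCycle-edge earCycle-wrap adj-sym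

    reach-cycle : ∀ x y → x ≤ b' → y ≤ b' → Reach (cdist b x y) (lab x) (lab y)
    reach-cycle = Cycle.reach-cdist

    ear≤E∸1 : ∀ i → i ≤ l → i ≤ suc (l + δ')
    ear≤E∸1 i il = ≤-trans il (≤-trans (m≤m+n l δ') (n≤1+n _))

    reach-earCycle : ∀ i j → i ≤ suc (l + δ') → j ≤ suc (l + δ') → Reach (cdist E i j) (lab (earCycle i)) (lab (earCycle j))
    reach-earCycle = EarCycle.reach-cdist

    reach-ear : ∀ i j → 1 ≤ i → i ≤ l → 1 ≤ j → j ≤ l → Reach (cdist E i j) (lab (b' + i)) (lab (b' + j))
    reach-ear i j hi il hj jl = subst₂ (λ z w → Reach (cdist E i j) (lab z) (lab w)) (earCycle-ear i hi il) (earCycle-ear j hj jl) (reach-earCycle i j (ear≤E∸1 i il) (ear≤E∸1 j jl))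

    reach-ear-δ : ∀ i → 1 ≤ i → i ≤ l → Reach (β i) (lab (b' + i)) (lab δ)
    reach-ear-δ i hi il = subst₂ (λ z w → Reach (β i) (lab z) (lab w)) (earCycle-ear i hi il) earCycle-ℓ (reach-earCycle i ℓ (ear≤E∸1 i il) (s≤s (m≤m+n l δ')))

    reach-ear-0 : ∀ i → 1 ≤ i → i ≤ l → Reach (α i) (lab (b' + i)) (lab 0)
    reach-ear-0 i hi il = subst (λ z → Reach (α i) (lab z) (lab 0)) (earCycle-ear i hi il) (reach-earCycle i 0 (ear≤E∸1 i il) z≤n)

    reach-earToCycle : ∀ i y → 1 ≤ i → i ≤ l → y ≤ b' → Reach (earToCycle i y) (lab (b' + i)) (lab y)
    reach-earToCycle i y hi il hy with ⊓-sel (α i + cdist b 0 y) (β i + cdist b δ y)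
    ... | inj₁ e = subst (λ k → Reach k (lab (b' + i)) (lab y)) (sym e) (reach-trans (α i) (cdist b 0 y) _ _ _ (reach-ear-0 i hi il) (reach-cycle 0 y z≤n hy))
    ... | inj₂ e = subst (λ k → Reach k (lab (b' + i)) (lab y)) (sym e) (reach-trans (β i) (cdist b δ y) _ _ _ (reach-ear-δ i hi il) (reach-cycle δ y δ≤b' hy))

    reach-cycleToEar : ∀ i y → 1 ≤ i → i ≤ l → y ≤ b' → Reach (earToCycle i y) (lab y) (lab (b' + i))
    reach-cycleToEar i y hi il hy with ⊓-sel (α i + cdist b 0 y) (β i + cdist b δ y)
    ... | inj₁ e = subst (λ k → Reach k (lab y) (lab (b' + i))) (sym (trans e (trans (+-comm (α i) _) (cong₂ _+_ (cdist-sym b 0 y) (cdist-sym E i 0)))))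
                     (reach-trans (cdist b y 0) (cdist E 0 i) _ _ _ (reach-cycle y 0 hy z≤n) (subst (λ z → Reach (cdist E 0 i) (lab 0) (lab z)) (earCycle-ear i hi il) (reach-earCycle 0 i z≤n (ear≤E∸1 i il))))
    ... | inj₂ e = subst (λ k → Reach k (lab y) (lab (b' + i))) (sym (trans e (trans (+-comm (β i) _) (cong₂ _+_ (cdist-sym b δ y) (cdist-sym E i ℓ)))))
                     (reach-trans (cdist b y δ) (cdist E ℓ i) _ _ _ (reach-cycle y δ hy δ≤b')
                       (subst₂ (λ z w → Reach (cdist E ℓ i) (lab z) (lab w)) earCycle-ℓ (earCycle-ear i hi il)
                               (reach-earCycle ℓ i (s≤s (m≤m+n l δ')) (ear≤E∸1 i il))))

    reach-θdist : ∀ x y → x < n → y < n → Reach (θdist x y) (lab x) (lab y)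
    reach-θdist x y x< y< with position x x< | position y y<
    ... | onCycle .x hx | onCycle .y hy = subst (λ k → Reach k (lab x) (lab y)) (sym (θdist-cc x y hx hy)) (reach-cycle x y hx hy)
    ... | onCycle .x hx | onEar j hj jl = subst (λ k → Reach k (lab x) (lab (b' + j))) (sym (θdist-ce x j hx hj)) (reach-cycleToEar j x hj jl hx)
    ... | onEar i hi il | onCycle .y hy = subst (λ k → Reach k (lab (b' + i)) (lab y)) (sym (θdist-ec i y hi hy)) (reach-earToCycle i y hi il hy)
    ... | onEar i hi il | onEar j hj jl = subst (λ k → Reach k (lab (b' + i)) (lab (b' + j))) (sym (θdist-ee i j hi hj)) (reach-ear i j hi il hj jl)

  ∑ec ∑ee : ℕ
  ∑ec = ∑ (λ i → ∑ (earToCycle (suc i)) b) l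
  ∑ee = ∑ (λ j → ∑ (λ i → cdist E (suc i) (suc j)) l) l

  b+i≡b'+1+i : ∀ i → b + i ≡ b' + suc i
  b+i≡b'+1+i i = sym (+-suc b' i)

  ∑θdist-cycle-column : ∀ y → y ≤ b' → ∑ (λ x → θdist x y) n ≡ σ b + ∑ (λ i → earToCycle (suc i) y) l
  ∑θdist-cycle-column y hy = trans (∑-+ (λ x → θdist x y) b l) (cong₂ _+_
     (trans (∑-cong _ _ b (λ x x< → trans (θdist-cc x y (s≤s⁻¹ x<) hy) (cdist-sym b x y))) (∑-cdist≡σ b y (m≤n⇒m≤1+n hy)))
     (∑-cong _ _ l (λ i _ → trans (cong (λ z → θdist z y) (b+i≡b'+1+i i)) (θdist-ec (suc i) y (s≤s z≤n) hy))))

  ∑θdist-ear-column : ∀ j → ∑ (λ x → θdist x (b + j)) n ≡ ∑ (earToCycle (suc j)) b + ∑ (λ i → cdist E (suc i) (suc j)) l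
  ∑θdist-ear-column j = trans (∑-+ (λ x → θdist x (b + j)) b l) (cong₂ _+_
     (∑-cong _ _ b (λ x x< → trans (cong (θdist x) (b+i≡b'+1+i j)) (θdist-ce x (suc j) (s≤s⁻¹ x<) (s≤s z≤n))))
     (∑-cong _ _ l (λ i _ → trans (cong₂ θdist (b+i≡b'+1+i i) (b+i≡b'+1+i j)) (θdist-ee (suc i) (suc j) (s≤s z≤n) (s≤s z≤n)))))

  ∑□θdist : ∑ (λ y → ∑ (λ x → θdist x y) n) n ≡ b * σ b + ∑ec + (∑ec + ∑ee)
  ∑□θdist = begin
    ∑ (λ y → ∑ (λ x → θdist x y) n) (b + l) ≡⟨ ∑-+ _ b l ⟩
    ∑ (λ y → ∑ (λ x → θdist x y) n) b + ∑ (λ j → ∑ (λ x → θdist x (b + j)) n) l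
      ≡⟨ cong₂ _+_ (∑-cong _ _ b (λ y y< → ∑θdist-cycle-column y (s≤s⁻¹ y<))) (∑-cong _ _ l (λ j _ → ∑θdist-ear-column j)) ⟩
    ∑ (λ y → σ b + ∑ (λ i → earToCycle (suc i) y) l) b + ∑ (λ j → ∑ (earToCycle (suc j)) b + ∑ (λ i → cdist E (suc i) (suc j)) l) l
      ≡⟨ cong₂ _+_ (∑-distrib (λ _ → σ b) _ b) (∑-distrib _ _ l) ⟩
    ∑ (λ _ → σ b) b + ∑ (λ y → ∑ (λ i → earToCycle (suc i) y) l) b + (∑ec + ∑ee)
      ≡⟨ cong (λ z → z + ∑ (λ y → ∑ (λ i → earToCycle (suc i) y) l) b + (∑ec + ∑ee)) (∑-const (σ b) b) ⟩
    b * σ b + ∑ (λ y → ∑ (λ i → earToCycle (suc i) y) l) b + (∑ec + ∑ee)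
      ≡⟨ cong (λ z → b * σ b + z + (∑ec + ∑ee)) (∑-swap (λ i y → earToCycle (suc i) y) b l) ⟩
    b * σ b + ∑ec + (∑ec + ∑ee) ∎

  earToCycle-via-0 : ∀ i y → α i + δ ≤ β i → y < b → earToCycle i y ≡ α i + cdist b 0 y
  earToCycle-via-0 i y h y< = m≤n⇒m⊓n≡m (≤-trans (+-monoʳ-≤ (α i) (cdist₀≤δ+cdistδ y y<)) (≤-trans (≤-reflexive (sym (+-assoc (α i) δ _))) (+-monoˡ-≤ _ h)))

  earToCycle-via-δ : ∀ i y → β i + δ ≤ α i → y < b → earToCycle i y ≡ β i + cdist b δ y
  earToCycle-via-δ i y h y< = m≥n⇒m⊓n≡n (≤-trans (+-monoʳ-≤ (β i) (cdistδ≤δ+cdist₀ y y<)) (≤-trans (≤-reflexive (sym (+-assoc (β i) δ _))) (+-monoˡ-≤ _ h)))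

  earToCycle-balanced : ∀ i y → α i ≡ β i → earToCycle i y ≡ α i + (cdist b 0 y ⊓ cdist b δ y)
  earToCycle-balanced i y e rewrite e = sym (+-distribˡ-⊓ (β i) _ _)

  ∑earToCycle-via-0 : ∀ i → α i + δ ≤ β i → ∑ (earToCycle i) b ≡ b * α i + σ b
  ∑earToCycle-via-0 i h = trans (∑-cong _ _ b (λ y y< → earToCycle-via-0 i y h y<)) (trans (∑-distrib (λ _ → α i) _ b) (cong (_+ σ b) (∑-const (α i) b)))

  ∑earToCycle-via-δ : ∀ i → β i + δ ≤ α i → ∑ (earToCycle i) b ≡ b * β i + σ b
  ∑earToCycle-via-δ i h = trans (∑-cong _ _ b (λ y y< → earToCycle-via-δ i y h y<)) (trans (∑-distrib (λ _ → β i) _ b) (cong₂ _+_ (∑-const (β i) b) (∑-cdist≡σ b δ (m≤n⇒m≤1+n δ≤b'))))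

  ∑earToCycle-balanced : ∀ i → α i ≡ β i → ∑ (earToCycle i) b ≡ b * α i + ∑ (λ y → cdist b 0 y ⊓ cdist b δ y) b
  ∑earToCycle-balanced i e = trans (∑-cong _ _ b (λ y y< → earToCycle-balanced i y e)) (trans (∑-distrib (λ _ → α i) _ b) (cong (_+ ∑ (λ y → cdist b 0 y ⊓ cdist b δ y) b) (∑-const (α i) b)))

  Joined : (ℕ → ℕ) → ℕ → ℕ → Set
  Joined pos u v = ModelEdge (pos u) (pos v) ⊎ ModelEdge (pos v) (pos u)

  joined : ∀ {pos : ℕ → ℕ} {x s m y u v} → (∀ {a c} → ArcEdge x s m y a c → Joined pos a c) →
    ArcEdge x s m y u v ⊎ ArcEdge x s m y v u → Joined pos u v
  joined classify (inj₁ e) = classify e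
  joined classify (inj₂ e) with classify e
  ... | inj₁ e′ = inj₂ e′
  ... | inj₂ e′ = inj₁ e′

  -- A concrete theta graph H n p q is handled through a relabelling: pos sends its vertices to
  -- model positions and lab sends them back.
  module Relabelling (p q : ℕ) (pos lab : ℕ → ℕ)
    (pos<n : ∀ u → u < n → pos u < n)
    (lab<n : ∀ x → x < n → lab x < n)
    (lab∘pos : ∀ u → u < n → lab (pos u) ≡ u)
    (model-edge⇒adj : ∀ x y → ModelEdge x y → adj (H n p q) (lab x) (lab y) ≡ true)
    (adj⇒model-edge : ∀ u v → adj (H n p q) u v ≡ true → Joined pos u v)
    (∑-pos : ∀ g → ∑ (λ u → g (pos u)) n ≡ ∑ g n) where

    G : Graph
    G = H n p q

    open Realisation G lab lab<n model-edge⇒adj (edgeIn-sym (thetaEdges n p q))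
    open Walks G using (Reach; module DistanceFormula)

    modelDist : ℕ → ℕ → ℕ
    modelDist u v = θdist (pos u) (pos v)

    modelDist-step : ∀ u v w → u < n → v < n → w < n → adj G w v ≡ true → modelDist u v ≤ suc (modelDist u w)
    modelDist-step u v w u< _ _ e with adj⇒model-edge w v e
    ... | inj₁ e′ = proj₁ (θdist-step (pos u) (pos w) (pos v) (pos<n u u<) e′)
    ... | inj₂ e′ = proj₂ (θdist-step (pos u) (pos v) (pos w) (pos<n u u<) e′)

    open DistanceFormula modelDist modelDist-step (λ u u< → θdist-self (pos u) (pos<n u u<))
      (λ u v u< v< → subst₂ (Reach (modelDist u v)) (lab∘pos u u<) (lab∘pos v v<) (reach-θdist (pos u) (pos v) (pos<n u u<) (pos<n v v<)))
      (λ u v u< v< → θdist≤n (pos u) (pos v) (pos<n u u<) (pos<n v v<))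

    wiener≡∑△ : wiener G ≡ ∑△ modelDist n
    wiener≡∑△ = trans (sum-map-applyUpTo _ (λ x → x) n) (∑-cong _ _ n (λ v v< →
      trans (sum-map-applyUpTo _ (λ x → x) v) (∑-cong _ _ v (λ u u< → dist≡f u v (<-trans u< v<) v<))))

    twice-wiener : 2 * wiener G ≡ b * σ b + ∑ec + (∑ec + ∑ee)
    twice-wiener = begin
      2 * wiener G                                    ≡⟨ cong (2 *_) wiener≡∑△ ⟩
      2 * ∑△ modelDist n                              ≡⟨ 2∑△≡∑□ modelDist n (λ u v u< v< → θdist-sym (pos u) (pos v) (pos<n u u<) (pos<n v v<))
                                                                            (λ u u< → θdist-self (pos u) (pos<n u u<)) ⟩
      ∑ (λ v → ∑ (λ u → θdist (pos u) (pos v)) n) n   ≡⟨ ∑-cong _ _ n (λ v _ → ∑-pos (λ x → θdist x (pos v))) ⟩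
      ∑ (λ v → ∑ (λ x → θdist x (pos v)) n) n         ≡⟨ ∑-pos (λ y → ∑ (λ x → θdist x y) n) ⟩
      ∑ (λ y → ∑ (λ x → θdist x y) n) n               ≡⟨ ∑□θdist ⟩
      b * σ b + ∑ec + (∑ec + ∑ee)                     ∎

-- Closed forms, with the transmissions σ passed as arguments so that each parity class
-- becomes a polynomial identity (INLINE lets the ring solver see through them).

twiceWienerH1q+ : ℕ → ℕ → ℕ → ℕ → ℕ → ℕ → ℕ → ℕ
twiceWienerH1q+ b l h r σb σb' σE = b * σb + 2 * (b * (h * suc h) + (h + h) * σb + r * (b * suc h + σb')) + (l * σE + 2)
{-# INLINE twiceWienerH1q+ #-}

twiceWienerH22 : ℕ → ℕ → ℕ → ℕ
twiceWienerH22 b σb σd = b * σb + 2 * (b + (1 + σd))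
{-# INLINE twiceWienerH22 #-}
-- H n 1 q as a theta model: n = c + l' + 4 and q = l' + 2. The ear is the path of length q; the cycle, of
-- length b = n - q + 1, is the edge 0 — 1 followed by the long path traversed backwards.
module H1q (c l' : ℕ) where
  open ThetaModel (suc c) (suc l') 0 (s≤s z≤n) z≤n (s≤s (s≤s z≤n)) public

  l : ℕ
  l = suc l'

  path₁ path₂ path₃ : List (ℕ × ℕ)
  path₁ = arcEdges 0 2 0 1
  path₂ = arcEdges 0 2 l 1
  path₃ = arcEdges 0 (suc (suc l)) (suc c) 1

  Edge : ℕ → ℕ → Set
  Edge u v = edgeIn (path₁ ++ path₂ ++ path₃) u v ≡ true

  length₃ : (n + 1) ∸ (1 + suc l) ∸ 1 ≡ suc c
  length₃ = cong (_∸ 1) (m≡n+o⇒m∸n≡o (n + 1) (suc (suc l)) (suc (suc c)) (arith c l'))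
    where
    arith : ∀ c l' → suc (suc (suc c)) + suc l' + 1 ≡ suc (suc (suc l')) + suc (suc c)
    arith = solve-∀

  adj≡Edge : ∀ u v → (adj (H n 1 (suc l)) u v ≡ true) ≡ Edge u v
  adj≡Edge u v = cong (λ m → edgeIn (path₁ ++ path₂ ++ arcEdges 0 (suc (suc l)) m 1) u v ≡ true) length₃

  pos : ℕ → ℕ
  pos 0 = 0
  pos 1 = 1
  pos (suc (suc k)) with k <? l
  ... | yes _ = b' + suc k
  ... | no _ = b' ∸ (k ∸ l)

  lab : ℕ → ℕ
  lab 0 = 0
  lab 1 = 1
  lab (suc (suc x)) with suc (suc x) ≤? b'
  ... | yes _ = suc (suc (l + (b' ∸ suc (suc x))))
  ... | no _ = suc (suc (suc x) ∸ b')

  pos-ear : ∀ k → k < l → pos (suc (suc k)) ≡ b' + suc k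
  pos-ear k k< with k <? l
  ... | yes _ = refl
  ... | no ¬p = ⊥-elim (¬p k<)

  pos-path : ∀ j → pos (suc (suc (l + j))) ≡ b' ∸ j
  pos-path j with (l + j) <? l
  ... | yes p = ⊥-elim (<⇒≱ p (m≤m+n l j))
  ... | no _ = cong (b' ∸_) (m+n∸m≡n l j)

  lab-cycle : ∀ x → x ≤ c → lab (suc (suc x)) ≡ suc (suc (l + (b' ∸ suc (suc x))))
  lab-cycle x x≤ with suc (suc x) ≤? b'
  ... | yes _ = refl
  ... | no ¬p = ⊥-elim (¬p (s≤s (s≤s x≤)))

  lab-ear : ∀ i → lab (b' + suc i) ≡ suc (suc i)
  lab-ear i with suc (suc (c + suc i)) ≤? b'
  ... | yes p = ⊥-elim (1+n≰n (≤-trans (s≤s (m≤m+n c i)) (≤-trans (≤-reflexive (sym (+-suc c i))) (s≤s⁻¹ (s≤s⁻¹ p)))))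
  ... | no _ = cong suc (m+n∸m≡n c (suc i))

  data Vertex : ℕ → Set where
    end₀ : Vertex 0
    end₁ : Vertex 1
    earVertex : ∀ k → k < l → Vertex (suc (suc k))
    pathVertex : ∀ j → j ≤ c → Vertex (suc (suc (l + j)))

  vertex : ∀ u → u < n → Vertex u
  vertex 0 _ = end₀
  vertex 1 _ = end₁
  vertex (suc (suc k)) u< with k <? l
  ... | yes p = earVertex k p
  ... | no ¬p = subst (λ z → Vertex (suc (suc z))) (m+[n∸m]≡n l≤k) (pathVertex (k ∸ l) j≤)
    where
    l≤k : l ≤ k
    l≤k = ≮⇒≥ ¬p
    j≤ : k ∸ l ≤ c
    j≤ = ≤-trans (∸-monoˡ-≤ l (s≤s⁻¹ (s≤s⁻¹ (s≤s⁻¹ (≤-trans u< (≤-reflexive (arith c l'))))))) (≤-reflexive (m+n∸m≡n l c))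
      where
      arith : ∀ c l' → suc (suc (suc c)) + suc l' ≡ suc (suc (suc (suc l' + c)))
      arith = solve-∀

  lab∘pos : ∀ u → u < n → lab (pos u) ≡ u
  lab∘pos u u< with vertex u u<
  ... | end₀ = refl
  ... | end₁ = refl
  ... | earVertex k k< = trans (cong lab (pos-ear k k<)) (lab-ear k)
  ... | pathVertex j j≤ = trans (cong lab (trans (pos-path j) e1)) (trans (lab-cycle (c ∸ j) (m∸n≤m c j)) (cong (λ z → suc (suc (l + z))) (m∸[m∸n]≡n j≤)))
    where
    e1 : b' ∸ j ≡ suc (suc (c ∸ j))
    e1 = +-∸-assoc 2 j≤

  pos< : ∀ u → u < n → pos u < n
  pos< u u< with vertex u u<
  ... | end₀ = s≤s z≤n
  ... | end₁ = s≤s (s≤s z≤n)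
  ... | earVertex k k< = subst (_< n) (sym (pos-ear k k<)) (s≤s (+-monoʳ-≤ b' k<))
  ... | pathVertex j j≤ = subst (_< n) (sym (pos-path j)) (s≤s (≤-trans (m∸n≤m b' j) (m≤m+n b' l)))

  lab< : ∀ x → x < n → lab x < n
  lab< x x< with position x x<
  lab< .0 x< | onCycle 0 _ = s≤s z≤n
  lab< .1 x< | onCycle 1 _ = s≤s (s≤s z≤n)
  lab< .(suc (suc x')) x< | onCycle (suc (suc x')) hx = subst (_< n) (sym (lab-cycle x' (s≤s⁻¹ (s≤s⁻¹ hx))))
     (≤-trans (s≤s (s≤s (s≤s (+-monoʳ-≤ l (m∸n≤m c x'))))) (≤-reflexive (cong (λ z → suc (suc (suc z))) (+-comm l c))))
  ... | onEar (suc i) _ il = subst (_< n) (sym (lab-ear i)) (s≤s (s≤s (≤-trans il (≤-trans (m≤n+m l c) (n≤1+n _)))))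

  path₁-edge : ∀ {u v} → ArcEdge 0 2 0 1 u v → Joined pos u v
  path₁-edge (direct refl) = inj₁ (arc 0 (s≤s z≤n))
  path₁-edge (first ())
  path₁-edge (inner k ())
  path₁-edge (last j ())

  path₂-edge : ∀ {u v} → ArcEdge 0 2 l 1 u v → Joined pos u v
  path₂-edge (direct ())
  path₂-edge (first _) = inj₁ (subst (ModelEdge 0) (sym (pos-ear 0 (s≤s z≤n))) ear-first)
  path₂-edge (inner k k<) =
    inj₁ (subst₂ ModelEdge (sym (pos-ear k (<-trans (n<1+n k) k<))) (sym (pos-ear (suc k) k<)) (ear-mid (suc k) (s≤s z≤n) k<))
  path₂-edge (last _ refl) = inj₁ (subst (λ z → ModelEdge z 1) (sym (pos-ear l' ≤-refl)) ear-last)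

  path₃-edge : ∀ {u v} → ArcEdge 0 (suc (suc l)) (suc c) 1 u v → Joined pos u v
  path₃-edge (direct ())
  path₃-edge (first _) =
    inj₂ (subst (λ z → ModelEdge z 0) (sym (trans (cong (λ z → pos (suc (suc z))) (sym (+-identityʳ l))) (pos-path 0))) wrap)
  path₃-edge (inner k k<) =
    inj₂ (subst₂ ModelEdge (sym (trans (cong (λ z → pos (suc (suc z))) (sym (+-suc l k))) (pos-path (suc k))))
                           (sym (trans (pos-path k) (+-∸-assoc 1 (≤-trans (s≤s⁻¹ (<-trans (n<1+n _) k<)) (n≤1+n c)))))
                           (arc (b' ∸ suc k) (s≤s (m∸n≤m (suc c) k))))
  path₃-edge (last _ refl) =
    inj₂ (subst (ModelEdge 1) (sym (trans (pos-path c) (trans (+-∸-assoc 2 (≤-refl {c})) (cong (λ z → suc (suc z)) (n∸n≡0 c))))) (arc 1 (s≤s (s≤s z≤n))))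

  adj⇒model-edge : ∀ u v → Edge u v → Joined pos u v
  adj⇒model-edge u v h with edgeIn-++₃⁻ path₁ path₂ path₃ u v h
  ... | inj₁ h₁        = joined path₁-edge (arcEdge⁻ 0 2 0 1 u v h₁)
  ... | inj₂ (inj₁ h₂) = joined path₂-edge (arcEdge⁻ 0 2 l 1 u v h₂)
  ... | inj₂ (inj₂ h₃) = joined path₃-edge (arcEdge⁻ 0 (suc (suc l)) (suc c) 1 u v h₃)

  path₁⊆edges : ∀ u v → edgeIn path₁ u v ≡ true → Edge u v
  path₁⊆edges u v = edgeIn-++ˡ path₁ (path₂ ++ path₃) u v

  path₂⊆edges : ∀ u v → edgeIn path₂ u v ≡ true → Edge u v
  path₂⊆edges = edgeIn-++₃-second path₁ path₂ path₃

  path₃⊆edges : ∀ u v → edgeIn path₃ u v ≡ true → Edge u v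
  path₃⊆edges = edgeIn-++₃-third path₁ path₂ path₃

  model-edge⇒adj : ∀ p p' → ModelEdge p p' → Edge (lab p) (lab p')
  model-edge⇒adj .0 .1 (arc zero _) = path₁⊆edges 0 1 (arcEdges-direct 0 2 1)
  model-edge⇒adj .1 .2 (arc (suc zero) _) = subst (Edge 1) (sym (lab-cycle 0 z≤n)) (path₃⊆edges 1 (suc (suc (l + c))) (edgeIn-sym path₃ (suc (suc (l + c))) 1 (arcEdges-last 0 (suc (suc l)) c 1)))
  model-edge⇒adj .(suc (suc k)) .(suc (suc (suc k))) (arc (suc (suc k)) k<) =
    subst₂ Edge (sym (trans (lab-cycle k k≤) (cong (λ z → suc (suc (l + z))) ck)))
              (sym (lab-cycle (suc k) k<'))
              (subst (λ z → Edge (suc (suc z)) (suc (suc (l + t)))) (sym (+-suc l t))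
                     (path₃⊆edges (suc (suc (suc (l + t)))) (suc (suc (l + t)))
                                  (edgeIn-sym path₃ (suc (suc (l + t))) (suc (suc (suc (l + t)))) (arcEdges-inner 0 (suc (suc l)) (suc c) 1 t t<))))
    where
    k<' : suc k ≤ c
    k<' = s≤s⁻¹ (s≤s⁻¹ k<)
    k≤ : k ≤ c
    k≤ = <⇒≤ k<'
    t = c ∸ suc k
    ck : c ∸ k ≡ suc t
    ck = ∸-suc c k k<'
    t< : suc t < suc c
    t< = s≤s (subst (_≤ c) ck (m∸n≤m c k))
  model-edge⇒adj .b' .0 wrap =
    subst (λ z → Edge z 0) (sym (trans (trans (lab-cycle c ≤-refl) (cong (λ z → suc (suc (l + z))) (n∸n≡0 c))) (cong (λ z → suc (suc z)) (+-identityʳ l))))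
      (path₃⊆edges (suc (suc l)) 0 (edgeIn-sym path₃ 0 (suc (suc l)) (arcEdges-first 0 (suc (suc l)) (suc c) 1 (s≤s z≤n))))
  model-edge⇒adj .0 .(b' + 1) ear-first = subst (Edge 0) (sym (lab-ear 0)) (path₂⊆edges 0 2 (arcEdges-first 0 2 l 1 (s≤s z≤n)))
  model-edge⇒adj .(b' + suc i') .(b' + suc (suc i')) (ear-mid (suc i') _ il) = subst₂ Edge (sym (lab-ear i')) (sym (lab-ear (suc i'))) (path₂⊆edges (suc (suc i')) (suc (suc (suc i'))) (arcEdges-inner 0 2 l 1 i' il))
  model-edge⇒adj .(b' + l) .1 ear-last = subst (λ z → Edge z 1) (sym (lab-ear l')) (path₂⊆edges (suc (suc l')) 1 (arcEdges-last 0 2 l' 1))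

  ∑-pos : ∀ g → ∑ (λ u → g (pos u)) n ≡ ∑ g n
  ∑-pos g = begin
    ∑ (λ u → g (pos u)) n ≡⟨ cong (∑ (λ u → g (pos u))) en ⟩
    ∑ (λ u → g (pos u)) (2 + (l + suc c)) ≡⟨ ∑-+ _ 2 (l + suc c) ⟩
    ∑ (λ u → g (pos u)) 2 + ∑ (λ i → g (pos (2 + i))) (l + suc c) ≡⟨ cong (∑ (λ u → g (pos u)) 2 +_) (∑-+ _ l (suc c)) ⟩
    ∑ g 2 + (∑ (λ i → g (pos (2 + i))) l + ∑ (λ j → g (pos (2 + (l + j)))) (suc c))
      ≡⟨ cong (λ z → ∑ g 2 + z) (cong₂ _+_ (∑-cong _ _ l (λ i i< → cong g (pos-ear i i<))) (∑-cong _ _ (suc c) (λ j _ → cong g (pos-path j)))) ⟩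
    ∑ g 2 + (∑ (λ i → g (b' + suc i)) l + ∑ (λ j → g (b' ∸ j)) (suc c))
      ≡⟨ cong (λ z → ∑ g 2 + z) (+-comm (∑ (λ i → g (b' + suc i)) l) (∑ (λ j → g (b' ∸ j)) (suc c))) ⟩
    ∑ g 2 + (∑ (λ j → g (b' ∸ j)) (suc c) + ∑ (λ i → g (b' + suc i)) l) ≡⟨ sym (+-assoc (∑ g 2) _ _) ⟩
    ∑ g 2 + ∑ (λ j → g (b' ∸ j)) (suc c) + ∑ (λ i → g (b' + suc i)) l
      ≡⟨ cong₂ (λ z w → ∑ g 2 + z + w) rv (∑-cong _ _ l (λ i _ → cong g (sym (b+i≡b'+1+i i)))) ⟩
    ∑ g 2 + ∑ (λ t → g (2 + t)) (suc c) + ∑ (λ i → g (b + i)) l ≡⟨ cong (_+ ∑ (λ i → g (b + i)) l) (sym (∑-+ g 2 (suc c))) ⟩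
    ∑ g b + ∑ (λ i → g (b + i)) l ≡⟨ sym (∑-+ g b l) ⟩
    ∑ g n ∎
    where
    en : n ≡ 2 + (l + suc c)
    en = arith c l'
      where
      arith : ∀ c l' → suc (suc (suc c)) + suc l' ≡ 2 + (suc l' + suc c)
      arith = solve-∀
    rv : ∑ (λ j → g (b' ∸ j)) (suc c) ≡ ∑ (λ t → g (2 + t)) (suc c)
    rv = trans (∑-cong _ _ (suc c) (λ j j< → cong g (+-∸-assoc 2 (s≤s⁻¹ j<)))) (∑-reverse (λ t → g (2 + t)) (suc c))

  open Relabelling 1 (suc l) pos lab pos< lab< lab∘pos
    (λ x y e → subst id (sym (adj≡Edge (lab x) (lab y))) (model-edge⇒adj x y e))
    (λ u v e → adj⇒model-edge u v (subst id (adj≡Edge u v) e)) ∑-pos public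
    using (G; twice-wiener)

  E≡1+ℓ : E ≡ suc ℓ
  E≡1+ℓ = cong (λ z → suc (suc z)) (+-identityʳ l)

  α-small : ∀ j → j + j ≤ l → α j ≡ j
  α-small j h = trans (cong (λ z → z ⊓ (E ∸ z)) (∣-∣-identityʳ j)) (m≤n⇒m⊓n≡m (m+n≤o⇒m≤o∸n j (≤-trans h (≤-trans (n≤1+n l) (≤-trans (n≤1+n ℓ) (≤-reflexive (sym E≡1+ℓ)))))))

  E∸[ℓ∸j] : ∀ j → j ≤ ℓ → E ∸ (ℓ ∸ j) ≡ suc j
  E∸[ℓ∸j] j j≤ = trans (cong (_∸ (ℓ ∸ j)) E≡1+ℓ) (trans (+-∸-assoc 1 (m∸n≤m ℓ j)) (cong suc (m∸[m∸n]≡n j≤)))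

  β≡ : ∀ j → j ≤ ℓ → β j ≡ (ℓ ∸ j) ⊓ suc j
  β≡ j j≤ = trans (cong (λ z → z ⊓ (E ∸ z)) (m≤n⇒∣m-n∣≡n∸m j≤)) (cong ((ℓ ∸ j) ⊓_) (E∸[ℓ∸j] j j≤))

  β-small : ∀ j → j + j ≤ l → β j ≡ suc j
  β-small j h = trans (β≡ j j≤) (m≥n⇒m⊓n≡n (m+n≤o⇒m≤o∸n (suc j) (s≤s h)))
    where
    j≤ : j ≤ ℓ
    j≤ = ≤-trans (m≤m+n j j) (≤-trans h (n≤1+n l))

  αβ-middle : ∀ j → j + j ≡ ℓ → α j ≡ j × β j ≡ j
  αβ-middle j e = trans (cong (λ z → z ⊓ (E ∸ z)) (∣-∣-identityʳ j)) (m≤n⇒m⊓n≡m (m+n≤o⇒m≤o∸n j (≤-trans (≤-reflexive e) (≤-trans (n≤1+n ℓ) (≤-reflexive (sym E≡1+ℓ))))))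
           , trans (β≡ j j≤) (trans (cong (_⊓ suc j) (m≡n+o⇒m∸n≡o ℓ j j (sym e))) (m≤n⇒m⊓n≡m (n≤1+n j)))
    where
    j≤ : j ≤ ℓ
    j≤ = ≤-trans (m≤m+n j j) (≤-reflexive e)

  αβ-mirror : ∀ m → m ≤ ℓ → α (ℓ ∸ m) ≡ β m × β (ℓ ∸ m) ≡ α m
  αβ-mirror m m≤ = cong (λ z → z ⊓ (E ∸ z)) (trans (∣-∣-identityʳ (ℓ ∸ m)) (sym (m≤n⇒∣m-n∣≡n∸m m≤)))
              , cong (λ z → z ⊓ (E ∸ z)) (trans (trans (m≤n⇒∣m-n∣≡n∸m (m∸n≤m ℓ m)) (m∸[m∸n]≡n m≤)) (sym (∣-∣-identityʳ m)))

  earRow : ℕ → ℕ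
  earRow j = ∑ (earToCycle j) b

  earRow-near-0 : ∀ j → j + j ≤ l → earRow j ≡ b * j + σ b
  earRow-near-0 j h = trans (∑earToCycle-via-0 j (≤-reflexive (trans (cong (_+ 1) (α-small j h)) (trans (+-comm j 1) (sym (β-small j h)))))) (cong (λ z → b * z + σ b) (α-small j h))

  earRow-near-δ : ∀ m → m + m ≤ l → earRow (ℓ ∸ m) ≡ b * m + σ b
  earRow-near-δ m h =
    trans (∑earToCycle-via-δ (ℓ ∸ m) (≤-reflexive (trans (cong (_+ 1) (trans βmirror (α-small m h)))
                                                         (trans (+-comm m 1) (sym (trans αmirror (β-small m h)))))))
          (cong (λ z → b * z + σ b) (trans βmirror (α-small m h)))
    where
    mirror : α (ℓ ∸ m) ≡ β m × β (ℓ ∸ m) ≡ α m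
    mirror = αβ-mirror m (≤-trans (m≤m+n m m) (≤-trans h (n≤1+n l)))
    αmirror : α (ℓ ∸ m) ≡ β m
    αmirror = proj₁ mirror
    βmirror : β (ℓ ∸ m) ≡ α m
    βmirror = proj₂ mirror

  earRow-middle : ∀ j → j + j ≡ ℓ → earRow j ≡ b * j + σ b'
  earRow-middle j e = trans (∑earToCycle-balanced j (trans (proj₁ (αβ-middle j e)) (sym (proj₂ (αβ-middle j e))))) (cong₂ _+_ (cong (b *_) (proj₁ (αβ-middle j e))) (∑-cdist-0⊓1 b'))

  halfSum : ℕ → ℕ
  halfSum h = ∑ (λ k → b * suc k + σ b) h

  ∑earRow-middle : ∀ h r → r ≤ 1 → l ≡ h + (r + h) → ∑ (λ i → earRow (suc (h + i))) r ≡ r * (b * suc h + σ b')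
  ∑earRow-middle h zero _ _ = refl
  ∑earRow-middle h (suc zero) _ el = trans (cong (λ z → 0 + earRow (suc z)) (+-identityʳ h)) (trans (earRow-middle (suc h) (cong suc (sym el))) (sym (+-identityʳ _)))
  ∑earRow-middle h (suc (suc _)) (s≤s ()) _

  2h≤l : ∀ h r → l ≡ h + (r + h) → h + h ≤ l
  2h≤l h r el = ≤-trans (m≤m+n (h + h) r) (≤-reflexive (trans (arith h r) (sym el)))
    where
    arith : ∀ h r → h + h + r ≡ h + (r + h)
    arith = solve-∀

  ∑earRow-first : ∀ h r → l ≡ h + (r + h) → ∑ (λ i → earRow (suc i)) h ≡ halfSum h
  ∑earRow-first h r el = ∑-cong _ _ h (λ i i< → earRow-near-0 (suc i) (≤-trans (+-mono-≤ i< i<) (2h≤l h r el)))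

  ∑earRow-last : ∀ h r → l ≡ h + (r + h) → ∑ (λ i → earRow (suc (h + (r + i)))) h ≡ halfSum h
  ∑earRow-last h r el = begin
    ∑ (λ i → earRow (suc (h + (r + i)))) h ≡⟨ ∑-cong _ _ h (λ i i< → trans (cong earRow (mirrored i i<)) (earRow-near-δ (h ∸ i) (2[h∸i]≤l i))) ⟩
    ∑ (λ i → b * (h ∸ i) + σ b) h           ≡⟨ ∑-cong _ _ h (λ i i< → cong (λ z → b * z + σ b) (∸-suc h i i<)) ⟩
    ∑ (λ i → b * suc (h ∸ suc i) + σ b) h   ≡⟨ ∑-reverse (λ k → b * suc k + σ b) h ⟩
    halfSum h                               ∎
    where
    2[h∸i]≤l : ∀ i → (h ∸ i) + (h ∸ i) ≤ l
    2[h∸i]≤l i = ≤-trans (+-mono-≤ (m∸n≤m h i) (m∸n≤m h i)) (2h≤l h r el)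
    mirrored : ∀ i → i < h → suc (h + (r + i)) ≡ ℓ ∸ (h ∸ i)
    mirrored i i< = sym (m≡n+o⇒m∸n≡o ℓ (h ∸ i) (suc (h + (r + i)))
                      (trans (cong suc el) (arith i (h ∸ i) r h (sym (m+[n∸m]≡n (<⇒≤ i<))))))
      where
      arith : ∀ i e r h → h ≡ i + e → suc (h + (r + h)) ≡ e + suc (h + (r + i))
      arith i e r .(i + e) refl = normalise i e r
        where
        normalise : ∀ i e r → suc (i + e + (r + (i + e))) ≡ e + suc (i + e + (r + i))
        normalise = solve-∀

  -- With l = h + r + h, the first h ear vertices reach the cycle through 0, the last h through δ = 1, and a
  -- middle vertex (r = 1) is as far from both.
  ∑ec≡halves : ∀ h r → r ≤ 1 → l ≡ h + (r + h) → ∑ec ≡ halfSum h + halfSum h + r * (b * suc h + σ b')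
  ∑ec≡halves h r r≤1 el = begin
    ∑ (λ i → earRow (suc i)) l                                        ≡⟨ cong (∑ (λ i → earRow (suc i))) el ⟩
    ∑ (λ i → earRow (suc i)) (h + (r + h))                            ≡⟨ ∑-+ _ h (r + h) ⟩
    ∑ (λ i → earRow (suc i)) h + ∑ (λ i → earRow (suc (h + i))) (r + h) ≡⟨ cong (∑ (λ i → earRow (suc i)) h +_) (∑-+ _ r h) ⟩
    ∑ (λ i → earRow (suc i)) h + (∑ (λ i → earRow (suc (h + i))) r + ∑ (λ i → earRow (suc (h + (r + i)))) h)
      ≡⟨ cong₂ _+_ (∑earRow-first h r el) (cong₂ _+_ (∑earRow-middle h r r≤1 el) (∑earRow-last h r el)) ⟩
    halfSum h + (r * (b * suc h + σ b') + halfSum h)                  ≡⟨ arith (halfSum h) (r * (b * suc h + σ b')) ⟩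
    halfSum h + halfSum h + r * (b * suc h + σ b')                    ∎
    where
    arith : ∀ x y → x + (y + x) ≡ x + x + y
    arith = solve-∀

  2halfSum≡ : ∀ h → halfSum h + halfSum h ≡ b * (h * suc h) + (h + h) * σ b
  2halfSum≡ h = begin
    halfSum h + halfSum h ≡⟨ cong₂ _+_ e e ⟩
    (b * ∑ suc h + h * σ b) + (b * ∑ suc h + h * σ b) ≡⟨ arith b (∑ suc h) h (σ b) ⟩
    b * (∑ suc h + ∑ suc h) + (h + h) * σ b ≡⟨ cong (λ z → b * z + (h + h) * σ b) (2∑suc≡ h) ⟩
    b * (h * suc h) + (h + h) * σ b ∎
    where
    e : halfSum h ≡ b * ∑ suc h + h * σ b
    e = trans (∑-distrib (λ k → b * suc k) (λ _ → σ b) h) (cong₂ _+_ (∑-*ˡ b suc h) (∑-const (σ b) h))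
    arith : ∀ b s h t → (b * s + h * t) + (b * s + h * t) ≡ b * (s + s) + (h + h) * t
    arith = solve-∀

  ∑cdist-ear-column : ∀ x → x < E → cdist E 0 x + ∑ (λ i → cdist E (suc i) x) l + cdist E ℓ x ≡ σ E
  ∑cdist-ear-column x x< = begin
    cdist E 0 x + ∑ (λ i → cdist E (suc i) x) l + cdist E ℓ x
      ≡⟨ cong (λ z → cdist E 0 x + ∑ (λ i → cdist E (suc i) x) z + cdist E (suc z) x) (sym (+-identityʳ l)) ⟩
    cdist E 0 x + ∑ (λ i → cdist E (suc i) x) (l + 0) + cdist E (suc (l + 0)) x
      ≡⟨ cong (_+ cdist E (suc (l + 0)) x) (sym (∑-sucˡ (λ i → cdist E i x) (l + 0))) ⟩
    ∑ (λ i → cdist E i x) E ≡⟨ ∑-cong _ _ E (λ i _ → cdist-sym E i x) ⟩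
    ∑ (cdist E x) E ≡⟨ ∑-cdist≡σ E x (<⇒≤ x<) ⟩
    σ E ∎

  regroup-ends : ∀ y a c t L → a + 1 ≡ t → c + 1 ≡ t → a + y + c ≡ L → y + t + t ≡ L + 2
  regroup-ends y a c .(a + 1) .(a + y + c) refl e refl = trans (cong (λ z → y + (a + 1) + z) (sym e)) (arith y a c)
    where
    arith : ∀ y a c → y + (a + 1) + (c + 1) ≡ a + y + c + 2
    arith = solve-∀

  -- The ear and its two ends exhaust C_E, so each ear column of C_E sums to σ E.
  ∑ee+2σE≡ : ∑ee + σ E + σ E ≡ l * σ E + 2
  ∑ee+2σE≡ = regroup-ends ∑ee (∑ (λ j → cdist E 0 (suc j)) l) (∑ (λ j → cdist E ℓ (suc j)) l) (σ E) (l * σ E) column-0 column-ℓ inner-columns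
    where
    column-0 : ∑ (λ j → cdist E 0 (suc j)) l + 1 ≡ σ E
    column-0 = trans (cong₂ _+_ (∑-cong _ _ l (λ j _ → cdist-sym E 0 (suc j))) (sym cdist-ℓ0)) (∑cdist-ear-column 0 (s≤s z≤n))
    column-ℓ : ∑ (λ j → cdist E ℓ (suc j)) l + 1 ≡ σ E
    column-ℓ = trans (+-comm _ 1) (trans (cong₂ _+_ (sym cdist-0ℓ) (∑-cong _ _ l (λ j _ → cdist-sym E ℓ (suc j))))
           (trans (sym (+-identityʳ _)) (trans (cong (λ z → cdist E 0 ℓ + ∑ (λ i → cdist E (suc i) ℓ) l + z) (sym (cdist-self E ℓ)))
             (∑cdist-ear-column ℓ (≤-reflexive (sym E≡1+ℓ))))))
    inner-columns : ∑ (λ j → cdist E 0 (suc j)) l + ∑ee + ∑ (λ j → cdist E ℓ (suc j)) l ≡ l * σ E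
    inner-columns = trans (sym (trans (∑-distrib (λ j → cdist E 0 (suc j) + ∑ (λ i → cdist E (suc i) (suc j)) l) (λ j → cdist E ℓ (suc j)) l)
                     (cong (_+ ∑ (λ j → cdist E ℓ (suc j)) l) (∑-distrib (λ j → cdist E 0 (suc j)) (λ j → ∑ (λ i → cdist E (suc i) (suc j)) l) l))))
               (trans (∑-cong _ _ l (λ j j< → ∑cdist-ear-column (suc j) (≤-trans (n≤1+n _) (≤-trans (s≤s (s≤s j<)) (≤-reflexive (sym E≡1+ℓ)))))) (∑-const (σ E) l))

  ∑ec≡ : ∀ h r → r ≤ 1 → l ≡ h + (r + h) → ∑ec ≡ b * (h * suc h) + (h + h) * σ b + r * (b * suc h + σ b')
  ∑ec≡ h r r≤1 el = trans (∑ec≡halves h r r≤1 el) (cong (_+ r * (b * suc h + σ b')) (2halfSum≡ h))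

  twice-wiener+ : ∀ h r → r ≤ 1 → l ≡ h + (r + h) →
    2 * wiener G + 2 * σ (suc ℓ) ≡ twiceWienerH1q+ b l h r (σ b) (σ b') (σ (suc ℓ))
  twice-wiener+ h r r≤1 el = subst (λ e → 2 * wiener G + 2 * σ e ≡ twiceWienerH1q+ b l h r (σ b) (σ b') (σ e)) E≡1+ℓ (begin
    2 * wiener G + 2 * σ E                   ≡⟨ cong (_+ 2 * σ E) twice-wiener ⟩
    b * σ b + ∑ec + (∑ec + ∑ee) + 2 * σ E    ≡⟨ regroup (b * σ b) ∑ec ∑ee (σ E) ⟩
    b * σ b + 2 * ∑ec + (∑ee + σ E + σ E)    ≡⟨ cong₂ (λ x y → b * σ b + 2 * x + y) (∑ec≡ h r r≤1 el) ∑ee+2σE≡ ⟩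
    twiceWienerH1q+ b l h r (σ b) (σ b') (σ E) ∎)
    where
    regroup : ∀ a x y t → a + x + (x + y) + 2 * t ≡ a + 2 * x + (y + t + t)
    regroup = solve-∀
-- H n 2 2 as a theta model: n = d + 5. The ear is one path of length 2 (inner vertex 3); the cycle, of
-- length n - 1, is the other one (inner vertex 2) followed by the long path traversed backwards.
module H22 (d : ℕ) where
  open ThetaModel (suc (suc d)) 1 1 (s≤s z≤n) (s≤s z≤n) (s≤s (s≤s (s≤s (s≤s z≤n)))) public

  path₁ path₂ path₃ : List (ℕ × ℕ)
  path₁ = arcEdges 0 2 1 1
  path₂ = arcEdges 0 3 1 1
  path₃ = arcEdges 0 4 (suc d) 1

  Edge : ℕ → ℕ → Set
  Edge u v = edgeIn (path₁ ++ path₂ ++ path₃) u v ≡ true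

  length₃ : (n + 1) ∸ (2 + 2) ∸ 1 ≡ suc d
  length₃ = cong (_∸ 1) (m≡n+o⇒m∸n≡o (n + 1) 4 (suc (suc d)) (arith d))
    where
    arith : ∀ d → suc (suc (suc (suc d))) + 1 + 1 ≡ 4 + suc (suc d)
    arith = solve-∀

  adj≡Edge : ∀ u v → (adj (H n 2 2) u v ≡ true) ≡ Edge u v
  adj≡Edge u v = cong (λ m → edgeIn (path₁ ++ path₂ ++ arcEdges 0 4 m 1) u v ≡ true) length₃

  pos : ℕ → ℕ
  pos 0 = 0
  pos 1 = 2
  pos 2 = 1
  pos 3 = b' + 1
  pos (suc (suc (suc (suc j)))) = b' ∸ j

  lab : ℕ → ℕ
  lab 0 = 0
  lab 1 = 2
  lab 2 = 1
  lab (suc (suc (suc x))) with suc (suc (suc x)) ≤? b'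
  ... | yes _ = 4 + (b' ∸ suc (suc (suc x)))
  ... | no _ = 3

  lab-cycle : ∀ x → x ≤ d → lab (suc (suc (suc x))) ≡ 4 + (d ∸ x)
  lab-cycle x x≤ with suc (suc (suc x)) ≤? b'
  ... | yes _ = refl
  ... | no ¬p = ⊥-elim (¬p (s≤s (s≤s (s≤s x≤))))

  lab-ear : lab (b' + 1) ≡ 3
  lab-ear with suc (suc (suc (d + 1))) ≤? b'
  ... | yes p = ⊥-elim (1+n≰n (≤-trans (≤-reflexive (+-comm 1 d)) (s≤s⁻¹ (s≤s⁻¹ (s≤s⁻¹ p)))))
  ... | no _ = refl

  data Vertex : ℕ → Set where
    end₀ : Vertex 0
    end₁ : Vertex 1
    end₂ : Vertex 2
    earVertex : Vertex 3
    pathVertex : ∀ j → j ≤ d → Vertex (suc (suc (suc (suc j))))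

  vertex : ∀ u → u < n → Vertex u
  vertex 0 _ = end₀
  vertex 1 _ = end₁
  vertex 2 _ = end₂
  vertex 3 _ = earVertex
  vertex (suc (suc (suc (suc j)))) u< = pathVertex j (s≤s⁻¹ (s≤s⁻¹ (s≤s⁻¹ (s≤s⁻¹ (s≤s⁻¹ (≤-trans u< (≤-reflexive (+-comm (suc (suc (suc (suc d)))) 1)))))))) 

  b'∸ : ∀ j → j ≤ d → b' ∸ j ≡ suc (suc (suc (d ∸ j)))
  b'∸ j j≤ = +-∸-assoc 3 j≤

  lab∘pos : ∀ u → u < n → lab (pos u) ≡ u
  lab∘pos u u< with vertex u u<
  ... | end₀ = refl
  ... | end₁ = refl
  ... | end₂ = refl
  ... | earVertex = lab-ear
  ... | pathVertex j j≤ = trans (cong lab (b'∸ j j≤)) (trans (lab-cycle (d ∸ j) (m∸n≤m d j)) (cong (4 +_) (m∸[m∸n]≡n j≤)))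

  pos< : ∀ u → u < n → pos u < n
  pos< u u< with vertex u u<
  ... | end₀ = s≤s z≤n
  ... | end₁ = s≤s (s≤s (s≤s z≤n))
  ... | end₂ = s≤s (s≤s z≤n)
  ... | earVertex = ≤-reflexive (cong suc refl)
  ... | pathVertex j j≤ = s≤s (≤-trans (m∸n≤m b' j) (m≤m+n b' 1))

  lab< : ∀ x → x < n → lab x < n
  lab< x x< with position x x<
  lab< .0 x< | onCycle 0 _ = s≤s z≤n
  lab< .1 x< | onCycle 1 _ = s≤s (s≤s (s≤s z≤n))
  lab< .2 x< | onCycle 2 _ = s≤s (s≤s z≤n)
  lab< .(suc (suc (suc x'))) x< | onCycle (suc (suc (suc x'))) hx = subst (_< n) (sym (lab-cycle x' (s≤s⁻¹ (s≤s⁻¹ (s≤s⁻¹ hx)))))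
     (s≤s (s≤s (s≤s (s≤s (≤-trans (s≤s (m∸n≤m d x')) (≤-reflexive (+-comm 1 d)))))))
  ... | onEar (suc zero) _ _ = subst (_< n) (sym lab-ear) (s≤s (s≤s (s≤s (s≤s z≤n))))
  ... | onEar (suc (suc _)) _ (s≤s ())

  path₁-edge : ∀ {u v} → ArcEdge 0 2 1 1 u v → Joined pos u v
  path₁-edge (direct ())
  path₁-edge (first _) = inj₁ (arc 0 (s≤s z≤n))
  path₁-edge (inner k (s≤s ()))
  path₁-edge (last _ refl) = inj₁ (arc 1 (s≤s (s≤s z≤n)))

  path₂-edge : ∀ {u v} → ArcEdge 0 3 1 1 u v → Joined pos u v
  path₂-edge (direct ())
  path₂-edge (first _) = inj₁ ear-first
  path₂-edge (inner k (s≤s ()))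
  path₂-edge (last _ refl) = inj₁ ear-last

  path₃-edge : ∀ {u v} → ArcEdge 0 4 (suc d) 1 u v → Joined pos u v
  path₃-edge (direct ())
  path₃-edge (first _) = inj₂ wrap
  path₃-edge (inner k k<) =
    inj₂ (subst (ModelEdge (b' ∸ suc k)) (sym (∸-suc b' k (≤-trans (s≤s⁻¹ k<) (≤-trans (n≤1+n d) (≤-trans (n≤1+n _) (n≤1+n _))))))
                (arc (b' ∸ suc k) (s≤s (m∸n≤m (suc (suc d)) k))))
  path₃-edge (last _ refl) =
    inj₂ (subst (ModelEdge 2) (sym (trans (b'∸ d ≤-refl) (cong (λ z → suc (suc (suc z))) (n∸n≡0 d)))) (arc 2 (s≤s (s≤s (s≤s z≤n)))))

  adj⇒model-edge : ∀ u v → Edge u v → Joined pos u v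
  adj⇒model-edge u v h with edgeIn-++₃⁻ path₁ path₂ path₃ u v h
  ... | inj₁ h₁        = joined path₁-edge (arcEdge⁻ 0 2 1 1 u v h₁)
  ... | inj₂ (inj₁ h₂) = joined path₂-edge (arcEdge⁻ 0 3 1 1 u v h₂)
  ... | inj₂ (inj₂ h₃) = joined path₃-edge (arcEdge⁻ 0 4 (suc d) 1 u v h₃)

  path₁⊆edges : ∀ u v → edgeIn path₁ u v ≡ true → Edge u v
  path₁⊆edges u v = edgeIn-++ˡ path₁ (path₂ ++ path₃) u v

  path₂⊆edges : ∀ u v → edgeIn path₂ u v ≡ true → Edge u v
  path₂⊆edges = edgeIn-++₃-second path₁ path₂ path₃

  path₃⊆edges : ∀ u v → edgeIn path₃ u v ≡ true → Edge u v
  path₃⊆edges = edgeIn-++₃-third path₁ path₂ path₃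

  model-edge⇒adj : ∀ p p' → ModelEdge p p' → Edge (lab p) (lab p')
  model-edge⇒adj .0 .1 (arc zero _) = path₁⊆edges 0 2 (arcEdges-first 0 2 1 1 (s≤s z≤n))
  model-edge⇒adj .1 .2 (arc (suc zero) _) = path₁⊆edges 2 1 (arcEdges-last 0 2 0 1)
  model-edge⇒adj .2 .3 (arc (suc (suc zero)) _) = subst (Edge 1) (sym (lab-cycle 0 z≤n)) (path₃⊆edges 1 (4 + d) (edgeIn-sym path₃ (4 + d) 1 (arcEdges-last 0 4 d 1)))
  model-edge⇒adj .(suc (suc (suc k))) .(suc (suc (suc (suc k)))) (arc (suc (suc (suc k))) k<) =
    subst₂ Edge (sym (trans (lab-cycle k (<⇒≤ k<')) (cong (4 +_) ck))) (sym (lab-cycle (suc k) k<'))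
      (path₃⊆edges (5 + t) (4 + t) (edgeIn-sym path₃ (4 + t) (5 + t) (arcEdges-inner 0 4 (suc d) 1 t t<)))
    where
    k<' : suc k ≤ d
    k<' = s≤s⁻¹ (s≤s⁻¹ (s≤s⁻¹ k<))
    t = d ∸ suc k
    ck : d ∸ k ≡ suc t
    ck = ∸-suc d k k<'
    t< : suc t < suc d
    t< = s≤s (subst (_≤ d) ck (m∸n≤m d k))
  model-edge⇒adj .b' .0 wrap = subst (λ z → Edge z 0) (sym (trans (lab-cycle d ≤-refl) (cong (4 +_) (n∸n≡0 d)))) (path₃⊆edges 4 0 (edgeIn-sym path₃ 0 4 (arcEdges-first 0 4 (suc d) 1 (s≤s z≤n))))
  model-edge⇒adj .0 .(b' + 1) ear-first = subst (Edge 0) (sym lab-ear) (path₂⊆edges 0 3 (arcEdges-first 0 3 1 1 (s≤s z≤n)))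
  model-edge⇒adj .(b' + i) .(b' + suc i) (ear-mid i hi (s≤s il)) = ⊥-elim (1+n≰n {0} (≤-trans hi il))
  model-edge⇒adj .(b' + 1) .2 ear-last = subst (λ z → Edge z 1) (sym lab-ear) (path₂⊆edges 3 1 (arcEdges-last 0 3 0 1))

  ∑-pos : ∀ g → ∑ (λ u → g (pos u)) n ≡ ∑ g n
  ∑-pos g = begin
    ∑ (λ u → g (pos u)) n ≡⟨ cong (∑ (λ u → g (pos u))) en ⟩
    ∑ (λ u → g (pos u)) (4 + suc d) ≡⟨ ∑-+ _ 4 (suc d) ⟩
    (0 + g 0 + g 2 + g 1 + g (b' + 1)) + ∑ (λ j → g (b' ∸ j)) (suc d) ≡⟨ cong₂ (λ z w → (0 + g 0 + g 2 + g 1 + g z) + w) e4 rv ⟩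
    (0 + g 0 + g 2 + g 1 + g (3 + (suc d + 0))) + ∑ (λ t → g (3 + t)) (suc d) ≡⟨ arith (g 0) (g 1) (g 2) (g (3 + (suc d + 0))) (∑ (λ t → g (3 + t)) (suc d)) ⟩
    ∑ g 3 + (∑ (λ t → g (3 + t)) (suc d) + (0 + g (3 + (suc d + 0)))) ≡⟨ cong (∑ g 3 +_) (sym (∑-+ (λ t → g (3 + t)) (suc d) 1)) ⟩
    ∑ g 3 + ∑ (λ t → g (3 + t)) (suc d + 1) ≡⟨ sym (∑-+ g 3 (suc d + 1)) ⟩
    ∑ g (3 + (suc d + 1)) ≡⟨ cong (∑ g) (sym en2) ⟩
    ∑ g n ∎
    where
    en : n ≡ 4 + suc d
    en = +-comm (suc (suc (suc (suc d)))) 1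
    en2 : n ≡ 3 + (suc d + 1)
    en2 = arith₂ d
      where
      arith₂ : ∀ d → suc (suc (suc (suc d))) + 1 ≡ 3 + (suc d + 1)
      arith₂ = solve-∀
    e4 : b' + 1 ≡ 3 + (suc d + 0)
    e4 = arith₃ d
      where
      arith₃ : ∀ d → suc (suc (suc d)) + 1 ≡ 3 + (suc d + 0)
      arith₃ = solve-∀
    rv : ∑ (λ j → g (b' ∸ j)) (suc d) ≡ ∑ (λ t → g (3 + t)) (suc d)
    rv = trans (∑-cong _ _ (suc d) (λ j j< → cong g (b'∸ j (s≤s⁻¹ j<)))) (∑-reverse (λ t → g (3 + t)) (suc d))
    arith : ∀ a0 a1 a2 a3 r → 0 + a0 + a2 + a1 + a3 + r ≡ (0 + a0 + a1 + a2) + (r + (0 + a3))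
    arith = solve-∀

  open Relabelling 2 2 pos lab pos< lab< lab∘pos
    (λ x y e → subst id (sym (adj≡Edge (lab x) (lab y))) (model-edge⇒adj x y e))
    (λ u v e → adj⇒model-edge u v (subst id (adj≡Edge u v) e)) ∑-pos public
    using (G; twice-wiener)

  ∑ec≡ : ∑ec ≡ b * 1 + (1 + σ (suc (suc d)))
  ∑ec≡ = trans (∑earToCycle-balanced 1 refl) (cong (b * 1 +_) (∑-cdist-0⊓2 (suc (suc d))))

  twice-wiener-formula : 2 * wiener G ≡ twiceWienerH22 b (σ b) (σ (suc (suc d)))
  twice-wiener-formula = begin
    2 * wiener G                ≡⟨ twice-wiener ⟩
    b * σ b + ∑ec + (∑ec + 0)   ≡⟨ cong (λ x → b * σ b + x + (x + 0)) ∑ec≡ ⟩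
    b * σ b + (b * 1 + (1 + σ (suc (suc d)))) + ((b * 1 + (1 + σ (suc (suc d)))) + 0)
                                ≡⟨ regroup (b * σ b) b (σ (suc (suc d))) ⟩
    twiceWienerH22 b (σ b) (σ (suc (suc d))) ∎
    where
    regroup : ∀ a b s → a + (b * 1 + (1 + s)) + ((b * 1 + (1 + s)) + 0) ≡ a + 2 * (b + (1 + s))
    regroup = solve-∀

-- Comparing the closed forms

σ-even-at : ∀ m k → m ≡ k + k → σ m ≡ k * k
σ-even-at .(k + k) k refl = σ-even k

σ-odd-at : ∀ m k → m ≡ suc (k + k) → σ m ≡ k * k + k
σ-odd-at .(suc (k + k)) k refl = σ-odd k

<-by-slack : ∀ {a b} k → b ≡ suc (a + k) → a < b
<-by-slack {a} k eq = ≤-trans (s≤s (m≤m+n a k)) (≤-reflexive (sym eq))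

half-< : ∀ {w₁ w₂} K → 2 * w₁ + K < 2 * w₂ + K → w₁ < w₂
half-< {w₁} {w₂} K lt = *-cancelˡ-< 2 w₁ w₂ (+-cancelʳ-< K (2 * w₁) (2 * w₂) lt)

-- H n 1 q with an ear of l' + 1 = h + r + h inner vertices and a cycle of length c + 3.
record H1qShape (n q : ℕ) : Set where
  field
    c l' h r : ℕ
    n≡  : n ≡ 3 + c + suc l'
    q≡  : q ≡ 2 + l'
    r≤1 : r ≤ 1
    l≡  : suc l' ≡ h + (r + h)

  twice-wiener-H1q : 2 * wiener (H n 1 q) + 2 * σ (3 + l') ≡
                     twiceWienerH1q+ (3 + c) (suc l') h r (σ (3 + c)) (σ (2 + c)) (σ (3 + l'))
  twice-wiener-H1q rewrite n≡ | q≡ = H1q.twice-wiener+ c l' h r r≤1 l≡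

-- H n 2 2 with a cycle of length d + 4.
record H22Shape (n : ℕ) : Set where
  field
    d  : ℕ
    n≡ : n ≡ 4 + d + 1

  twice-wiener-H22 : 2 * wiener (H n 2 2) ≡ twiceWienerH22 (4 + d) (σ (4 + d)) (σ (2 + d))
  twice-wiener-H22 rewrite n≡ = H22.twice-wiener-formula d

module Compare {n q : ℕ} (s₁ : H1qShape n q) (s₂ : H22Shape n) where
  open H1qShape s₁
  open H22Shape s₂ using (d; twice-wiener-H22)

  H1q<H22-by : ∀ {σb σb' σE σD σD'} → σ (3 + c) ≡ σb → σ (2 + c) ≡ σb' → σ (3 + l') ≡ σE →
    σ (4 + d) ≡ σD → σ (2 + d) ≡ σD' →
    ∀ k → twiceWienerH22 (4 + d) σD σD' + 2 * σE ≡ suc (twiceWienerH1q+ (3 + c) (suc l') h r σb σb' σE + k) →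
    wiener (H n 1 q) < wiener (H n 2 2)
  H1q<H22-by refl refl refl refl refl k eq = half-< (2 * σ (3 + l'))
    (subst₂ _<_ (sym twice-wiener-H1q) (cong (_+ 2 * σ (3 + l')) (sym twice-wiener-H22)) (<-by-slack k eq))

  H22<H1q-by : ∀ {σb σb' σE σD σD'} → σ (3 + c) ≡ σb → σ (2 + c) ≡ σb' → σ (3 + l') ≡ σE →
    σ (4 + d) ≡ σD → σ (2 + d) ≡ σD' →
    ∀ k → twiceWienerH1q+ (3 + c) (suc l') h r σb σb' σE ≡ suc (twiceWienerH22 (4 + d) σD σD' + 2 * σE + k) →
    wiener (H n 2 2) < wiener (H n 1 q)
  H22<H1q-by refl refl refl refl refl k eq = half-< (2 * σ (3 + l'))
    (subst₂ _<_ (cong (_+ 2 * σ (3 + l')) (sym twice-wiener-H22)) (sym twice-wiener-H1q) (<-by-slack k eq))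

wiener-H1q≡ : ∀ {n q} (s : H1qShape n q) → ∀ w → let open H1qShape s in
  twiceWienerH1q+ (3 + c) (suc l') h r (σ (3 + c)) (σ (2 + c)) (σ (3 + l')) ≡ 2 * w + 2 * σ (3 + l') → wiener (H n 1 q) ≡ w
wiener-H1q≡ s w e = *-cancelˡ-≡ _ _ 2 (+-cancelʳ-≡ (2 * σ (3 + l')) _ _ (trans twice-wiener-H1q e))
  where open H1qShape s

wiener-H22≡ : ∀ {n} (s : H22Shape n) → ∀ w → let open H22Shape s in
  twiceWienerH22 (4 + d) (σ (4 + d)) (σ (2 + d)) ≡ 2 * w → wiener (H n 2 2) ≡ w
wiener-H22≡ s w e = *-cancelˡ-≡ _ _ 2 (trans twice-wiener-H22 e)
  where open H22Shape s

H1qShape-of : ∀ c l' h r → r ≤ 1 → suc l' ≡ h + (r + h) → H1qShape (3 + c + suc l') (2 + l')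
H1qShape-of c l' h r r≤1 l≡ = record { c = c ; l' = l' ; h = h ; r = r ; n≡ = refl ; q≡ = refl ; r≤1 = r≤1 ; l≡ = l≡ }

H22Shape-of : ∀ d → H22Shape (4 + d + 1)
H22Shape-of d = record { d = d ; n≡ = refl }

H1q<H22-q3-n-even : ∀ {n q} V → n ≡ 12 + 2 * V → q ≡ 3 → wiener (H n 1 q) < wiener (H n 2 2)
H1q<H22-q3-n-even {n} {q} V n≡ q≡ = Compare.H1q<H22-by shape₁ shape₂
  (σ-even-at (10 + 2 * V) (5 + V) (solve (V ∷ []))) (σ-odd-at (9 + 2 * V) (4 + V) (solve (V ∷ []))) (σ-even-at 4 2 refl)
  (σ-odd-at (11 + 2 * V) (5 + V) (solve (V ∷ []))) (σ-odd-at (9 + 2 * V) (4 + V) (solve (V ∷ [])))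
  (1 + 5 * V + V * V) (identity V)
  where
  shape₁ : H1qShape n q
  shape₁ = record { c = 7 + 2 * V ; l' = 1 ; h = 1 ; r = 0 ; n≡ = trans n≡ (solve (V ∷ [])) ; q≡ = q≡
                  ; r≤1 = z≤n ; l≡ = refl }
  shape₂ : H22Shape n
  shape₂ = record { d = 7 + 2 * V ; n≡ = trans n≡ (solve (V ∷ [])) }
  identity : ∀ V → twiceWienerH22 (11 + 2 * V) ((5 + V) * (5 + V) + (5 + V)) ((4 + V) * (4 + V) + (4 + V)) + 2 * (2 * 2) ≡
                   suc (twiceWienerH1q+ (10 + 2 * V) 2 1 0 ((5 + V) * (5 + V)) ((4 + V) * (4 + V) + (4 + V)) (2 * 2) + (1 + 5 * V + V * V))
  identity = solve-∀

H1q<H22-q3-n-odd : ∀ {n q} V → n ≡ 9 + 2 * V → q ≡ 3 → wiener (H n 1 q) < wiener (H n 2 2)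
H1q<H22-q3-n-odd {n} {q} V n≡ q≡ = Compare.H1q<H22-by shape₁ shape₂
  (σ-odd-at (7 + 2 * V) (3 + V) (solve (V ∷ []))) (σ-even-at (6 + 2 * V) (3 + V) (solve (V ∷ []))) (σ-even-at 4 2 refl)
  (σ-even-at (8 + 2 * V) (4 + V) (solve (V ∷ []))) (σ-even-at (6 + 2 * V) (3 + V) (solve (V ∷ [])))
  (1 + 3 * V + V * V) (identity V)
  where
  shape₁ : H1qShape n q
  shape₁ = record { c = 4 + 2 * V ; l' = 1 ; h = 1 ; r = 0 ; n≡ = trans n≡ (solve (V ∷ [])) ; q≡ = q≡
                  ; r≤1 = z≤n ; l≡ = refl }
  shape₂ : H22Shape n
  shape₂ = record { d = 4 + 2 * V ; n≡ = trans n≡ (solve (V ∷ [])) }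
  identity : ∀ V → twiceWienerH22 (8 + 2 * V) ((4 + V) * (4 + V)) ((3 + V) * (3 + V)) + 2 * (2 * 2) ≡
                   suc (twiceWienerH1q+ (7 + 2 * V) 2 1 0 ((3 + V) * (3 + V) + (3 + V)) ((3 + V) * (3 + V)) (2 * 2) + (1 + 3 * V + V * V))
  identity = solve-∀

H1q<H22-q-odd≥5-n-even : ∀ {n q} U V → n ≡ 10 + 4 * U + 2 * V → q ≡ 5 + 2 * U → wiener (H n 1 q) < wiener (H n 2 2)
H1q<H22-q-odd≥5-n-even {n} {q} U V n≡ q≡ = Compare.H1q<H22-by shape₁ shape₂
  (σ-even-at (6 + 2 * U + 2 * V) (3 + U + V) (solve (U ∷ V ∷ []))) (σ-odd-at (5 + 2 * U + 2 * V) (2 + U + V) (solve (U ∷ V ∷ []))) (σ-even-at (6 + 2 * U) (3 + U) (solve (U ∷ V ∷ [])))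
  (σ-odd-at (9 + 4 * U + 2 * V) (4 + 2 * U + V) (solve (U ∷ V ∷ []))) (σ-odd-at (7 + 4 * U + 2 * V) (3 + 2 * U + V) (solve (U ∷ V ∷ [])))
  (5 + 13 * V + 3 * V * V + 26 * U + 20 * U * V + 2 * U * V * V + 20 * U * U + 6 * U * U * V + 4 * U * U * U) (identity U V)
  where
  shape₁ : H1qShape n q
  shape₁ = record { c = 3 + 2 * U + 2 * V ; l' = 3 + 2 * U ; h = 2 + U ; r = 0 ; n≡ = trans n≡ (solve (U ∷ V ∷ [])) ; q≡ = q≡
                  ; r≤1 = z≤n ; l≡ = solve (U ∷ V ∷ []) }
  shape₂ : H22Shape n
  shape₂ = record { d = 5 + 4 * U + 2 * V ; n≡ = trans n≡ (solve (U ∷ V ∷ [])) }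
  identity : ∀ U V → twiceWienerH22 (9 + 4 * U + 2 * V) ((4 + 2 * U + V) * (4 + 2 * U + V) + (4 + 2 * U + V)) ((3 + 2 * U + V) * (3 + 2 * U + V) + (3 + 2 * U + V)) + 2 * ((3 + U) * (3 + U)) ≡
                   suc (twiceWienerH1q+ (6 + 2 * U + 2 * V) (4 + 2 * U) (2 + U) 0 ((3 + U + V) * (3 + U + V)) ((2 + U + V) * (2 + U + V) + (2 + U + V)) ((3 + U) * (3 + U)) + (5 + 13 * V + 3 * V * V + 26 * U + 20 * U * V + 2 * U * V * V + 20 * U * U + 6 * U * U * V + 4 * U * U * U))
  identity = solve-∀

H1q<H22-q-odd≥5-n-odd : ∀ {n q} U V → n ≡ 11 + 4 * U + 2 * V → q ≡ 5 + 2 * U → wiener (H n 1 q) < wiener (H n 2 2)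
H1q<H22-q-odd≥5-n-odd {n} {q} U V n≡ q≡ = Compare.H1q<H22-by shape₁ shape₂
  (σ-odd-at (7 + 2 * U + 2 * V) (3 + U + V) (solve (U ∷ V ∷ []))) (σ-even-at (6 + 2 * U + 2 * V) (3 + U + V) (solve (U ∷ V ∷ []))) (σ-even-at (6 + 2 * U) (3 + U) (solve (U ∷ V ∷ [])))
  (σ-even-at (10 + 4 * U + 2 * V) (5 + 2 * U + V) (solve (U ∷ V ∷ []))) (σ-even-at (8 + 4 * U + 2 * V) (4 + 2 * U + V) (solve (U ∷ V ∷ [])))
  (19 + 17 * V + 3 * V * V + 39 * U + 22 * U * V + 2 * U * V * V + 23 * U * U + 6 * U * U * V + 4 * U * U * U) (identity U V)
  where
  shape₁ : H1qShape n q
  shape₁ = record { c = 4 + 2 * U + 2 * V ; l' = 3 + 2 * U ; h = 2 + U ; r = 0 ; n≡ = trans n≡ (solve (U ∷ V ∷ [])) ; q≡ = q≡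
                  ; r≤1 = z≤n ; l≡ = solve (U ∷ V ∷ []) }
  shape₂ : H22Shape n
  shape₂ = record { d = 6 + 4 * U + 2 * V ; n≡ = trans n≡ (solve (U ∷ V ∷ [])) }
  identity : ∀ U V → twiceWienerH22 (10 + 4 * U + 2 * V) ((5 + 2 * U + V) * (5 + 2 * U + V)) ((4 + 2 * U + V) * (4 + 2 * U + V)) + 2 * ((3 + U) * (3 + U)) ≡
                   suc (twiceWienerH1q+ (7 + 2 * U + 2 * V) (4 + 2 * U) (2 + U) 0 ((3 + U + V) * (3 + U + V) + (3 + U + V)) ((3 + U + V) * (3 + U + V)) ((3 + U) * (3 + U)) + (19 + 17 * V + 3 * V * V + 39 * U + 22 * U * V + 2 * U * V * V + 23 * U * U + 6 * U * U * V + 4 * U * U * U))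
  identity = solve-∀

H1q<H22-q-even-n-even : ∀ {n q} U V → n ≡ 8 + 4 * U + 2 * V → q ≡ 4 + 2 * U → wiener (H n 1 q) < wiener (H n 2 2)
H1q<H22-q-even-n-even {n} {q} U V n≡ q≡ = Compare.H1q<H22-by shape₁ shape₂
  (σ-odd-at (5 + 2 * U + 2 * V) (2 + U + V) (solve (U ∷ V ∷ []))) (σ-even-at (4 + 2 * U + 2 * V) (2 + U + V) (solve (U ∷ V ∷ []))) (σ-odd-at (5 + 2 * U) (2 + U) (solve (U ∷ V ∷ [])))
  (σ-odd-at (7 + 4 * U + 2 * V) (3 + 2 * U + V) (solve (U ∷ V ∷ []))) (σ-odd-at (5 + 4 * U + 2 * V) (2 + 2 * U + V) (solve (U ∷ V ∷ [])))
  (1 + 6 * V + 2 * V * V + 12 * U + 14 * U * V + 2 * U * V * V + 14 * U * U + 6 * U * U * V + 4 * U * U * U) (identity U V)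
  where
  shape₁ : H1qShape n q
  shape₁ = record { c = 2 + 2 * U + 2 * V ; l' = 2 + 2 * U ; h = 1 + U ; r = 1 ; n≡ = trans n≡ (solve (U ∷ V ∷ [])) ; q≡ = q≡
                  ; r≤1 = s≤s z≤n ; l≡ = solve (U ∷ V ∷ []) }
  shape₂ : H22Shape n
  shape₂ = record { d = 3 + 4 * U + 2 * V ; n≡ = trans n≡ (solve (U ∷ V ∷ [])) }
  identity : ∀ U V → twiceWienerH22 (7 + 4 * U + 2 * V) ((3 + 2 * U + V) * (3 + 2 * U + V) + (3 + 2 * U + V)) ((2 + 2 * U + V) * (2 + 2 * U + V) + (2 + 2 * U + V)) + 2 * ((2 + U) * (2 + U) + (2 + U)) ≡
                   suc (twiceWienerH1q+ (5 + 2 * U + 2 * V) (3 + 2 * U) (1 + U) 1 ((2 + U + V) * (2 + U + V) + (2 + U + V)) ((2 + U + V) * (2 + U + V)) ((2 + U) * (2 + U) + (2 + U)) + (1 + 6 * V + 2 * V * V + 12 * U + 14 * U * V + 2 * U * V * V + 14 * U * U + 6 * U * U * V + 4 * U * U * U))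
  identity = solve-∀

H1q<H22-q-even-n-odd : ∀ {n q} U V → n ≡ 9 + 4 * U + 2 * V → q ≡ 4 + 2 * U → wiener (H n 1 q) < wiener (H n 2 2)
H1q<H22-q-even-n-odd {n} {q} U V n≡ q≡ = Compare.H1q<H22-by shape₁ shape₂
  (σ-even-at (6 + 2 * U + 2 * V) (3 + U + V) (solve (U ∷ V ∷ []))) (σ-odd-at (5 + 2 * U + 2 * V) (2 + U + V) (solve (U ∷ V ∷ []))) (σ-odd-at (5 + 2 * U) (2 + U) (solve (U ∷ V ∷ [])))
  (σ-even-at (8 + 4 * U + 2 * V) (4 + 2 * U + V) (solve (U ∷ V ∷ []))) (σ-even-at (6 + 4 * U + 2 * V) (3 + 2 * U + V) (solve (U ∷ V ∷ [])))
  (5 + 8 * V + 2 * V * V + 19 * U + 16 * U * V + 2 * U * V * V + 17 * U * U + 6 * U * U * V + 4 * U * U * U) (identity U V)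
  where
  shape₁ : H1qShape n q
  shape₁ = record { c = 3 + 2 * U + 2 * V ; l' = 2 + 2 * U ; h = 1 + U ; r = 1 ; n≡ = trans n≡ (solve (U ∷ V ∷ [])) ; q≡ = q≡
                  ; r≤1 = s≤s z≤n ; l≡ = solve (U ∷ V ∷ []) }
  shape₂ : H22Shape n
  shape₂ = record { d = 4 + 4 * U + 2 * V ; n≡ = trans n≡ (solve (U ∷ V ∷ [])) }
  identity : ∀ U V → twiceWienerH22 (8 + 4 * U + 2 * V) ((4 + 2 * U + V) * (4 + 2 * U + V)) ((3 + 2 * U + V) * (3 + 2 * U + V)) + 2 * ((2 + U) * (2 + U) + (2 + U)) ≡
                   suc (twiceWienerH1q+ (6 + 2 * U + 2 * V) (3 + 2 * U) (1 + U) 1 ((3 + U + V) * (3 + U + V)) ((2 + U + V) * (2 + U + V) + (2 + U + V)) ((2 + U) * (2 + U) + (2 + U)) + (5 + 8 * V + 2 * V * V + 19 * U + 16 * U * V + 2 * U * V * V + 17 * U * U + 6 * U * U * V + 4 * U * U * U))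
  identity = solve-∀

H22<H12-n-even : ∀ {n} U → n ≡ 6 + 2 * U → wiener (H n 2 2) < wiener (H n 1 2)
H22<H12-n-even {n} U n≡ = Compare.H22<H1q-by shape₁ shape₂
  (σ-odd-at (5 + 2 * U) (2 + U) (solve (U ∷ []))) (σ-even-at (4 + 2 * U) (2 + U) (solve (U ∷ []))) (σ-odd-at 3 1 refl)
  (σ-odd-at (5 + 2 * U) (2 + U) (solve (U ∷ []))) (σ-odd-at (3 + 2 * U) (1 + U) (solve (U ∷ [])))
  (1 + 2 * U) (identity U)
  where
  shape₁ : H1qShape n 2
  shape₁ = record { c = 2 + 2 * U ; l' = 0 ; h = 0 ; r = 1 ; n≡ = trans n≡ (solve (U ∷ [])) ; q≡ = refl
                  ; r≤1 = s≤s z≤n ; l≡ = refl }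
  shape₂ : H22Shape n
  shape₂ = record { d = 1 + 2 * U ; n≡ = trans n≡ (solve (U ∷ [])) }
  identity : ∀ U → twiceWienerH1q+ (5 + 2 * U) 1 0 1 ((2 + U) * (2 + U) + (2 + U)) ((2 + U) * (2 + U)) (1 * 1 + 1) ≡
                   suc (twiceWienerH22 (5 + 2 * U) ((2 + U) * (2 + U) + (2 + U)) ((1 + U) * (1 + U) + (1 + U)) + 2 * (1 * 1 + 1) + (1 + 2 * U))
  identity = solve-∀

H22<H12-n-odd : ∀ {n} U → n ≡ 7 + 2 * U → wiener (H n 2 2) < wiener (H n 1 2)
H22<H12-n-odd {n} U n≡ = Compare.H22<H1q-by shape₁ shape₂
  (σ-even-at (6 + 2 * U) (3 + U) (solve (U ∷ []))) (σ-odd-at (5 + 2 * U) (2 + U) (solve (U ∷ []))) (σ-odd-at 3 1 refl)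
  (σ-even-at (6 + 2 * U) (3 + U) (solve (U ∷ []))) (σ-even-at (4 + 2 * U) (2 + U) (solve (U ∷ [])))
  (1 + 2 * U) (identity U)
  where
  shape₁ : H1qShape n 2
  shape₁ = record { c = 3 + 2 * U ; l' = 0 ; h = 0 ; r = 1 ; n≡ = trans n≡ (solve (U ∷ [])) ; q≡ = refl
                  ; r≤1 = s≤s z≤n ; l≡ = refl }
  shape₂ : H22Shape n
  shape₂ = record { d = 2 + 2 * U ; n≡ = trans n≡ (solve (U ∷ [])) }
  identity : ∀ U → twiceWienerH1q+ (6 + 2 * U) 1 0 1 ((3 + U) * (3 + U)) ((2 + U) * (2 + U) + (2 + U)) (1 * 1 + 1) ≡
                   suc (twiceWienerH22 (6 + 2 * U) ((3 + U) * (3 + U)) ((2 + U) * (2 + U)) + 2 * (1 * 1 + 1) + (1 + 2 * U))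
  identity = solve-∀

parity : ∀ m → ∃ λ k → m ≡ k + k ⊎ m ≡ suc (k + k)
parity zero    = 0 , inj₁ refl
parity (suc m) with parity m
... | k , inj₁ e = k , inj₂ (cong suc e)
... | k , inj₂ e = suc k , inj₁ (cong suc (trans e (sym (+-suc k k))))

m∸n≡k⇒m≡n+k : ∀ {m n k} → n ≤ m → m ∸ n ≡ k → m ≡ n + k
m∸n≡k⇒m≡n+k n≤m e = trans (sym (m+[n∸m]≡n n≤m)) (cong (_ +_) e)

too-small : ∀ {n} m → 9 ≤ n → n ≡ m → m < 9 → ⊥
too-small m 9≤n refl m<9 = <⇒≱ m<9 9≤n

split-n-q : ∀ {n q a b} → 3 ≤ q → q + q ≤ n → q ∸ 3 ≡ a → n ∸ (q + q) ≡ b → q ≡ 3 + a × n ≡ 3 + a + (3 + a) + b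
split-n-q {n} {q} {a} {b} 3≤q 2q≤n e₁ e₂ = q≡ , trans (m∸n≡k⇒m≡n+k 2q≤n e₂) (cong (λ x → x + x + b) q≡)
  where
  q≡ : q ≡ 3 + a
  q≡ = m∸n≡k⇒m≡n+k 3≤q e₁

H1q<H22-q-odd-n-even : ∀ {n q} U V → 9 ≤ n → n ≢ 10 → q ≡ 3 + (U + U) × n ≡ 3 + (U + U) + (3 + (U + U)) + (V + V) →
  wiener (H n 1 q) < wiener (H n 2 2)
H1q<H22-q-odd-n-even zero    zero                9≤n _    (_ , e) = ⊥-elim (too-small 6 9≤n e (from-yes (6 <? 9)))
H1q<H22-q-odd-n-even zero    (suc zero)          9≤n _    (_ , e) = ⊥-elim (too-small 8 9≤n e (from-yes (8 <? 9)))
H1q<H22-q-odd-n-even zero    (suc (suc zero))    _   n≢10 (_ , e) = ⊥-elim (n≢10 e)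
H1q<H22-q-odd-n-even zero    (suc (suc (suc V))) _   _    (eq , e) = H1q<H22-q3-n-even V (trans e (solve (V ∷ []))) eq
H1q<H22-q-odd-n-even (suc U) V                   _   _    (eq , e) =
  H1q<H22-q-odd≥5-n-even U V (trans e (solve (U ∷ V ∷ []))) (trans eq (solve (U ∷ [])))

H1q<H22-q-odd-n-odd : ∀ {n q} U V → 9 ≤ n → q ≡ 3 + (U + U) × n ≡ 3 + (U + U) + (3 + (U + U)) + suc (V + V) →
  wiener (H n 1 q) < wiener (H n 2 2)
H1q<H22-q-odd-n-odd zero    zero    9≤n (_ , e)  = ⊥-elim (too-small 7 9≤n e (from-yes (7 <? 9)))
H1q<H22-q-odd-n-odd zero    (suc V) _   (eq , e) = H1q<H22-q3-n-odd V (trans e (solve (V ∷ []))) eq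
H1q<H22-q-odd-n-odd (suc U) V       _   (eq , e) =
  H1q<H22-q-odd≥5-n-odd U V (trans e (solve (U ∷ V ∷ []))) (trans eq (solve (U ∷ [])))

H1q<H22 : ∀ n q → 9 ≤ n → n ≢ 10 → 3 ≤ q → q + q ≤ n → wiener (H n 1 q) < wiener (H n 2 2)
H1q<H22 n q 9≤n n≢10 3≤q 2q≤n with parity (q ∸ 3) | parity (n ∸ (q + q))
... | U , inj₁ u | V , inj₁ v = H1q<H22-q-odd-n-even U V 9≤n n≢10 (split-n-q 3≤q 2q≤n u v)
... | U , inj₁ u | V , inj₂ v = H1q<H22-q-odd-n-odd U V 9≤n (split-n-q 3≤q 2q≤n u v)
... | U , inj₂ u | V , inj₁ v = let (eq , e) = split-n-q 3≤q 2q≤n u v in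
  H1q<H22-q-even-n-even U V (trans e (solve (U ∷ V ∷ []))) (trans eq (solve (U ∷ [])))
... | U , inj₂ u | V , inj₂ v = let (eq , e) = split-n-q 3≤q 2q≤n u v in
  H1q<H22-q-even-n-odd U V (trans e (solve (U ∷ V ∷ []))) (trans eq (solve (U ∷ [])))

H22<H12 : ∀ n → 9 ≤ n → wiener (H n 2 2) < wiener (H n 1 2)
H22<H12 n 9≤n with parity (n ∸ 6)
... | U , inj₁ e = H22<H12-n-even U (trans (m∸n≡k⇒m≡n+k 6≤n e) (solve (U ∷ [])))
  where
  6≤n : 6 ≤ n
  6≤n = ≤-trans (from-yes (6 ≤? 9)) 9≤n
... | U , inj₂ e = H22<H12-n-odd U (trans (m∸n≡k⇒m≡n+k 6≤n e) (solve (U ∷ [])))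
  where
  6≤n : 6 ≤ n
  6≤n = ≤-trans (from-yes (6 ≤? 9)) 9≤n

q≤n/2⇒q+q≤n : ∀ n q → q ≤ n / 2 → q + q ≤ n
q≤n/2⇒q+q≤n n q q≤n/2 = ≤-trans (≤-reflexive (double q)) (≤-trans (*-monoˡ-≤ 2 q≤n/2) (m/n*n≤m n 2))
  where
  double : ∀ q → q + q ≡ q * 2
  double = solve-∀

9≤n-of : ∀ {n} → n ≡ 9 ⊎ 11 ≤ n → 9 ≤ n
9≤n-of (inj₁ refl) = ≤-refl
9≤n-of (inj₂ 11≤n) = ≤-trans (from-yes (9 ≤? 11)) 11≤n

≢10-of : ∀ {n} → n ≡ 9 ⊎ 11 ≤ n → n ≢ 10
≢10-of (inj₁ refl) ()
≢10-of (inj₂ 11≤n) refl = <⇒≱ (from-yes (10 <? 11)) 11≤n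

wiener-H1q-value : ∀ c l' h r w → {r≤1 : True (r ≤? 1)} → {l≡ : True (suc l' ≟ h + (r + h))} →
  {e : True (twiceWienerH1q+ (3 + c) (suc l') h r (σ (3 + c)) (σ (2 + c)) (σ (3 + l')) ≟ 2 * w + 2 * σ (3 + l'))} →
  wiener (H (3 + c + suc l') 1 (2 + l')) ≡ w
wiener-H1q-value c l' h r w {r≤1} {l≡} {e} = wiener-H1q≡ (H1qShape-of c l' h r (toWitness r≤1) (toWitness l≡)) w (toWitness e)

wiener-H22-value : ∀ d w → {e : True (twiceWienerH22 (4 + d) (σ (4 + d)) (σ (2 + d)) ≟ 2 * w)} → wiener (H (4 + d + 1) 2 2) ≡ w
wiener-H22-value d w {e} = wiener-H22≡ (H22Shape-of d) w (toWitness e)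

proposition5 : ((n q : ℕ) → (n ≡ 9 ⊎ 11 ≤ n) → 3 ≤ q → q ≤ n / 2 →
    (wiener (H n 1 q) < wiener (H n 2 2)) × (wiener (H n 2 2) < wiener (H n 1 2)))
    × (wiener (H 4 1 2) ≡ 7)
    × (wiener (H 5 1 2) ≡ 14) × (wiener (H 5 2 2) ≡ 14)
    × (wiener (H 6 1 2) ≡ 24) × (wiener (H 6 1 3) ≡ 25) × (wiener (H 6 2 2) ≡ 23)
    × (wiener (H 7 1 2) ≡ 39) × (wiener (H 7 1 3) ≡ 38) × (wiener (H 7 2 2) ≡ 38)
    × (wiener (H 8 1 2) ≡ 58) × (wiener (H 8 1 3) ≡ 58) × (wiener (H 8 1 4) ≡ 55)
    × (wiener (H 8 2 2) ≡ 56)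
    × (wiener (H 10 1 2) ≡ 115) × (wiener (H 10 1 3) ≡ 113) × (wiener (H 10 1 4) ≡ 107)
    × (wiener (H 10 1 5) ≡ 109) × (wiener (H 10 2 2) ≡ 112)
proposition5 =
  (λ n q n-ok 3≤q q≤n/2 → H1q<H22 n q (9≤n-of n-ok) (≢10-of n-ok) 3≤q (q≤n/2⇒q+q≤n n q q≤n/2) , H22<H12 n (9≤n-of n-ok))
  , wiener-H1q-value 0 0 0 1 7
  , wiener-H1q-value 1 0 0 1 14 , wiener-H22-value 0 14
  , wiener-H1q-value 2 0 0 1 24 , wiener-H1q-value 1 1 1 0 25 , wiener-H22-value 1 23
  , wiener-H1q-value 3 0 0 1 39 , wiener-H1q-value 2 1 1 0 38 , wiener-H22-value 2 38
  , wiener-H1q-value 4 0 0 1 58 , wiener-H1q-value 3 1 1 0 58 , wiener-H1q-value 2 2 1 1 55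
  , wiener-H22-value 3 56
  , wiener-H1q-value 6 0 0 1 115 , wiener-H1q-value 5 1 1 0 113 , wiener-H1q-value 4 2 1 1 107
  , wiener-H1q-value 3 3 2 0 109 , wiener-H22-value 5 112
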